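{- Let $H$ be an $n\times n$ $\{\pm1\}$-matrix, $G$ its $n$-full oriented hypergraph, and $\alpha$ a permutation of $\{1,\dots,n\}$. If $\sum_{c\in\mathcal{A}_\alpha}(-1)^{pc(c)}\ge 0$, then \[ |\det(H)|=n!-2|\mathcal{A}^-_\alpha|=2|\mathcal{A}^+_\alpha|-n!, \] and if $\sum_{c\in\mathcal{A}_\alpha}(-1)^{pc(c)}\le 0$, then \[ |\det(H)|=n!-2|\mathcal{A}^+_\alpha|=2|\mathcal{A}^-_\alpha|-n!. \]
   Context: Let $H=(h_{ij})$ be an $n\times n$ $\{\pm1\}$-matrix. Its $n$-full oriented hypergraph $G$ has vertices $v_1,\dots,v_n$, edges $e_1,\dots,e_n$, and exactly one incidence $(v_i,e_j)$ for every pair $i,j$, with orientation $\sigma(v_i,e_j)=h_{ij}$. A step is a triple $(v,e,w)$ (tail vertex $v$, edge $e$, head vertex $w$), with sign $-\sigma(v,e)\sigma(w,e)$; it is a backstep if $w=v$ (sign $-1$). A contributor $c$ consists of one step $(v,f(v),\pi(v))$ for each vertex $v$, where $f:V\to E$ is any function and $\pi:V\to V$ is a bijection. The components of $c$ are the cycles of $\pi$; the sign of a component is the product of the signs of its steps, and $pc(c)$ is the number of components of sign $+1$. The sign of the contributor $c$ is $(-1)^{pc(c)}$. $\mathcal{A}_\alpha$ is the set of all $n!$ contributors with $f(v_k)=e_{\alpha(k)}$ for all $k$ (the edge-monic tail-equivalence class with identifier $\alpha$); $\mathcal{A}^+_\alpha$ and $\mathcal{A}^-_\alpha$ are the sets of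 its contributors of sign $+1$ and $-1$ respectively. -}

module Defs where

open import Data.Nat using (ℕ; zero; suc; _<_; _≤_)
open import Data.Nat.Properties using (_<?_)
open import Data.Bool using (if_then_else_)
open import Data.Fin using (Fin; toℕ; _≟_)
open import Data.Fin.Properties using (all?; any?)
import Data.Fin.Properties as FinP
open import Data.Fin.Permutation using (Permutation′; _⟨$⟩ʳ_)
open import Data.Vec.Functional using () renaming (_∷_ to _∷ᶠ_)
open import Data.List using (List; []; _∷_; [_]; map; concatMap; filter; length; foldr; allFin)
open import Data.Product using (∃; _×_)
open import Data.Sign using (Sign; opposite) renaming (_*_ to _·_)
import Data.Sign as S
open import Data.Integer using (ℤ; +_; -_) renaming (_+_ to _+ℤ_; _*_ to _*ℤ_)
open import Data.Nat using (_%_)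
open import Relation.Binary.PropositionalEquality using (_≡_)
open import Relation.Nullary using (Dec; yes; no; ¬_)
open import Relation.Nullary.Decidable using (_→-dec_; _×-dec_)

SignMatrix : ℕ → Set
SignMatrix n = Fin n → Fin n → Sign

signToℤ : Sign → ℤ
signToℤ S.+ = + 1
signToℤ S.- = - (+ 1)

sumℤ : List ℤ → ℤ
sumℤ = foldr _+ℤ_ (+ 0)

prodℤ : List ℤ → ℤ
prodℤ = foldr _*ℤ_ (+ 1)

prodSign : List Sign → Sign
prodSign = foldr _·_ S.+

allFuns : (m n : ℕ) → List (Fin m → Fin n)
allFuns zero    n = [ (λ ()) ]
allFuns (suc m) n = concatMap (λ x → map (λ g → x ∷ᶠ g) (allFuns m n)) (allFin n)

IsInjective : {n : ℕ} → (Fin n → Fin n) → Set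
IsInjective {n} π = ∀ (i j : Fin n) → π i ≡ π j → i ≡ j

injective? : {n : ℕ} → (π : Fin n → Fin n) → Dec (IsInjective π)
injective? π = all? λ i → all? λ j → (π i ≟ π j) →-dec (i ≟ j)

perms : (n : ℕ) → List (Fin n → Fin n)
perms n = filter injective? (allFuns n n)

Inversion : {n : ℕ} → (Fin n → Fin n) → Fin n → Fin n → Set
Inversion π i j = (toℕ i < toℕ j) × (toℕ (π j) < toℕ (π i))

inversion? : {n : ℕ} (π : Fin n → Fin n) (i j : Fin n) → Dec (Inversion π i j)
inversion? π i j = (toℕ i <? toℕ j) ×-dec (toℕ (π j) <? toℕ (π i))

inversions : {n : ℕ} → (Fin n → Fin n) → ℕ
inversions {n} π = length (concatMap (λ i → filter (inversion? π i) (allFin n)) (allFin n))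

parity : ℕ → Sign
parity k = if Data.Nat._≡ᵇ_ (k % 2) 0 then S.+ else S.-

sgn : {n : ℕ} → (Fin n → Fin n) → Sign
sgn π = parity (inversions π)

det : {n : ℕ} → SignMatrix n → ℤ
det {n} H = sumℤ (map (λ π → signToℤ (sgn π) *ℤ prodℤ (map (λ i → signToℤ (H i (π i))) (allFin n))) (perms n))

-- n-full oriented hypergraph of H: σ(v_i, e_j) = h_ij.

σ : {n : ℕ} → SignMatrix n → Fin n → Fin n → Sign
σ H v e = H v e

stepSign : {n : ℕ} → SignMatrix n → Fin n → Fin n → Fin n → Sign
stepSign H v e w = opposite (σ H v e · σ H w e)

-- A contributor in A_α is determined by its bijection π:
-- steps (v_k, e_{α(k)}, v_{π(k)}).
iter : {n : ℕ} → (Fin n → Fin n) → ℕ → Fin n → Fin n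
iter π zero    v = v
iter π (suc k) v = π (iter π k v)

InOrbit : {n : ℕ} → (Fin n → Fin n) → Fin n → Fin n → Set
InOrbit {n} π v w = ∃ λ (k : Fin n) → iter π (toℕ k) v ≡ w

inOrbit? : {n : ℕ} (π : Fin n → Fin n) (v w : Fin n) → Dec (InOrbit π v w)
inOrbit? π v w = any? λ k → iter π (toℕ k) v ≟ w

-- v is the least vertex of its component (one representative per cycle)
IsLeader : {n : ℕ} → (Fin n → Fin n) → Fin n → Set
IsLeader {n} π v = ∀ (w : Fin n) → InOrbit π v w → toℕ v ≤ toℕ w

isLeader? : {n : ℕ} (π : Fin n → Fin n) (v : Fin n) → Dec (IsLeader π v)
isLeader? π v = all? λ w → inOrbit? π v w →-dec (toℕ v Data.Nat.≤? toℕ w)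

componentSign : {n : ℕ} → SignMatrix n → Permutation′ n → (Fin n → Fin n) → Fin n → Sign
componentSign {n} H α π v =
  prodSign (map (λ w → stepSign H w (α ⟨$⟩ʳ w) (π w)) (filter (inOrbit? π v) (allFin n)))

PositiveComponent : {n : ℕ} → SignMatrix n → Permutation′ n → (Fin n → Fin n) → Fin n → Set
PositiveComponent H α π v = IsLeader π v × (componentSign H α π v ≡ S.+)

positiveComponent? : {n : ℕ} (H : SignMatrix n) (α : Permutation′ n) (π : Fin n → Fin n) (v : Fin n)
  → Dec (PositiveComponent H α π v)
positiveComponent? H α π v = isLeader? π v ×-dec (componentSign H α π v Data.Sign.≟ S.+)

pc : {n : ℕ} → SignMatrix n → Permutation′ n → (Fin n → Fin n) → ℕ
pc {n} H α π = length (filter (positiveComponent? H α π) (allFin n))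

contributorSign : {n : ℕ} → SignMatrix n → Permutation′ n → (Fin n → Fin n) → Sign
contributorSign H α π = parity (pc H α π)

contributorSum : {n : ℕ} → SignMatrix n → Permutation′ n → ℤ
contributorSum {n} H α = sumℤ (map (λ π → signToℤ (contributorSign H α π)) (perms n))

A⁺-card : {n : ℕ} → SignMatrix n → Permutation′ n → ℕ
A⁺-card {n} H α = length (filter (λ π → contributorSign H α π Data.Sign.≟ S.+) (perms n))

A⁻-card : {n : ℕ} → SignMatrix n → Permutation′ n → ℕ
A⁻-card {n} H α = length (filter (λ π → contributorSign H α π Data.Sign.≟ S.-) (perms n))

-- Fix the contributor c of A_α with bijection π. A cycle of π has the sign ∏ -h(v,α v) h(π v,α v)
-- over its vertices v, and (-1)^[s = +] = -s for a sign s, so (-1)^pc(c) is (-1)^(#cycles of π)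
-- times ∏_v -h(v,α v) h(π v,α v). Since (-1)^(#cycles of π) = sgn π · (-1)^n, this is
-- sgn π · ∏_v h(v,α v) · ∏_v h(π v,α v). Summing over π and substituting π = τ⁻¹ ∘ α turns the
-- contributor sum into ± det H. The sum is also |A⁺_α| - |A⁻_α|, while |A⁺_α| + |A⁻_α| = n!,
-- and the two formulas follow according to its sign.
module Submission where

open import Defs

open import Data.Bool using (Bool; true; false; if_then_else_; not; _∧_; _xor_)
import Data.Bool.Properties as BoolP
open import Data.Empty using (⊥-elim)
open import Data.Fin using (Fin; zero; suc; toℕ; fromℕ<; punchOut)
import Data.Fin.Properties as FinP
open import Data.Fin.Permutation using (Permutation′; permutation; _⟨$⟩ʳ_; _⟨$⟩ˡ_; inverseˡ)
open import Data.Fin.Permutation.Components using (transpose)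
open import Data.Integer as ℤ using (ℤ; +_; -_; ∣_∣; _+_; _-_; _*_; _≤_; _≥_)
import Data.Integer.Properties as ℤP
open import Data.Integer.Tactic.RingSolver using (solve-∀)
open import Data.List using (List; []; _∷_; _++_; map; concatMap; filter; allFin; length; tabulate)
import Data.List.Properties as ListP
open import Data.Nat as ℕ using (ℕ; zero; suc; _!)
open import Data.Nat.DivMod using (_%_; _/_; m≡m%n+[m/n]*n; m%n<n)
import Data.Nat.Properties as ℕP
open import Data.Product as Product using (∃; _×_; _,_; proj₁; proj₂)
open import Data.Sign as Sign using (Sign) renaming (_*_ to _·_)
import Data.Sign.Properties as SignP
open import Data.Sum using (_⊎_; inj₁; inj₂)
open import Data.Vec.Functional using () renaming (_∷_ to _∷ᶠ_)
open import Function using (_∘_; id; mk⇔)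
open import Relation.Binary.Definitions using (tri<; tri≈; tri>)
open import Relation.Binary.PropositionalEquality
  using (_≡_; _≢_; _≗_; refl; sym; trans; cong; cong₂; subst; module ≡-Reasoning)
open import Relation.Nullary using (Dec; yes; no; does; ¬_)
open import Relation.Nullary.Decidable using (dec-true; dec-false; does-⇔; _×-dec_; _→-dec_; ¬?)

open import Algebra.Solver.CommutativeMonoid SignP.*-commutativeMonoid using (solve; _⊕_; _⊜_)
open import Algebra.Properties.CommutativeMonoid.Sum SignP.*-commutativeMonoid
  using (sum-replicate-zero)
  renaming ( sum to ∏; sum-cong-≗ to ∏-cong; ∑-distrib-+ to ∏-distrib
           ; ∑-comm to ∏-comm; ∑-permute to ∏-permute)

negIf : Bool → Sign
negIf true  = Sign.-
negIf false = Sign.+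

signIf : Bool → Sign → Sign
signIf b s = if b then s else Sign.+

∏-trivial : ∀ {n} {f : Fin n → Sign} → (∀ i → f i ≡ Sign.+) → ∏ f ≡ Sign.+
∏-trivial {n} f≡+ = trans (∏-cong f≡+) (sum-replicate-zero n)

∏-indicator : ∀ {n} (y : Fin n) (s : Sign) → ∏ (λ i → signIf (does (i FinP.≟ y)) s) ≡ s
∏-indicator {suc n} zero    s = trans (cong (s ·_) (sum-replicate-zero n)) (SignP.*-identityʳ s)
∏-indicator         (suc y) s = ∏-indicator y s

signIf-pair : ∀ b (s t : Sign) → s ≡ t → signIf b s · signIf (not b) t ≡ s
signIf-pair true  s t _   = SignP.*-identityʳ s
signIf-pair false s t s≡t = sym s≡t

∏²-distrib : ∀ {m n} (f g : Fin m → Fin n → Sign) →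
  (∏ λ i → ∏ λ j → f i j · g i j) ≡ (∏ λ i → ∏ (f i)) · (∏ λ i → ∏ (g i))
∏²-distrib f g =
  trans (∏-cong (λ i → ∏-distrib (f i) (g i))) (∏-distrib (λ i → ∏ (f i)) (λ i → ∏ (g i)))

∏-pairs : ∀ {n} → (Fin n → Fin n → Sign) → Sign
∏-pairs {zero}  W = Sign.+
∏-pairs {suc n} W = ∏ (λ j → W zero (suc j)) · ∏-pairs (λ i j → W (suc i) (suc j))

∏-tournament : ∀ {n} (R : Fin n → Fin n → Bool) →
  (∀ i → R i i ≡ false) → (∀ {i j} → i ≢ j → R j i ≡ not (R i j)) →
  (W : Fin n → Fin n → Sign) → (∀ i j → W i j ≡ W j i) →
  (∏ λ i → ∏ λ j → signIf (R i j) (W i j)) ≡ ∏-pairs W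
∏-tournament {zero}  R irrefl flip W W-sym = refl
∏-tournament {suc n} R irrefl flip W W-sym = begin
  (G zero zero · A) · ∏ (λ i → G (suc i) zero · ∏ λ j → G (suc i) (suc j))
    ≡⟨ cong ((G zero zero · A) ·_) (∏-distrib (λ i → G (suc i) zero) _) ⟩
  (G zero zero · A) · (B · C)
    ≡⟨ shuffle (G zero zero) A B C ⟩
  G zero zero · ((A · B) · C)
    ≡⟨ cong₂ (λ x y → x · (y · C)) G00≡+ A·B≡first-row ⟩
  ∏ (λ j → W zero (suc j)) · C
    ≡⟨ cong (∏ (λ j → W zero (suc j)) ·_) inner ⟩
  ∏-pairs W ∎
  where
  open ≡-Reasoning
  G : Fin (suc n) → Fin (suc n) → Sign
  G i j = signIf (R i j) (W i j)
  A B C : Sign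
  A = ∏ λ j → G zero (suc j)
  B = ∏ λ i → G (suc i) zero
  C = ∏ λ i → ∏ λ j → G (suc i) (suc j)

  shuffle : ∀ a b c d → (a · b) · (c · d) ≡ a · ((b · c) · d)
  shuffle = solve 4 (λ a b c d → (a ⊕ b) ⊕ (c ⊕ d) ⊜ a ⊕ ((b ⊕ c) ⊕ d)) refl

  G00≡+ : G zero zero ≡ Sign.+
  G00≡+ = cong (λ b → signIf b (W zero zero)) (irrefl zero)

  A·B≡first-row : A · B ≡ ∏ (λ j → W zero (suc j))
  A·B≡first-row = trans (sym (∏-distrib (λ j → G zero (suc j)) (λ j → G (suc j) zero))) (∏-cong λ j →
    trans (cong (λ b → G zero (suc j) · signIf b (W (suc j) zero)) (flip {zero} {suc j} λ ()))
          (signIf-pair (R zero (suc j)) _ _ (W-sym zero (suc j))))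

  inner : C ≡ ∏-pairs (λ i j → W (suc i) (suc j))
  inner = ∏-tournament (λ i j → R (suc i) (suc j)) (irrefl ∘ suc) (λ i≢j → flip (i≢j ∘ FinP.suc-injective))
                       (λ i j → W (suc i) (suc j)) (λ i j → W-sym (suc i) (suc j))

injective⇒surjective : ∀ {n} {f : Fin n → Fin n} → IsInjective f → ∀ y → ∃ λ x → f x ≡ y
injective⇒surjective {n} {f} f-inj y with FinP.any? (λ x → f x FinP.≟ y)
... | yes hit = hit
-- If y were missed, punching it out would inject Fin (suc m) into Fin m.
injective⇒surjective {suc m} {f} f-inj y | no miss
  with FinP.pigeonhole (ℕP.n<1+n m) (λ x → punchOut {i = y} (λ fx≡y → miss (x , sym fx≡y)))
... | i , j , i<j , eq = ⊥-elim (FinP.<⇒≢ i<j (f-inj i j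
       (FinP.punchOut-injective (λ e → miss (i , sym e)) (λ e → miss (j , sym e)) eq)))

-- Total, so that it can be written down before injectivity is known; for a non-injective f
-- it returns y itself on the points y outside the image.
_⁻¹ : ∀ {n} → (Fin n → Fin n) → Fin n → Fin n
(f ⁻¹) y with FinP.any? (λ x → f x FinP.≟ y)
... | yes (x , _) = x
... | no _        = y

module _ {n} {f : Fin n → Fin n} (f-inj : IsInjective f) where

  ⁻¹-inverseʳ : ∀ y → f ((f ⁻¹) y) ≡ y
  ⁻¹-inverseʳ y with FinP.any? (λ x → f x FinP.≟ y)
  ... | yes (_ , fx≡y) = fx≡y
  ... | no miss        = ⊥-elim (miss (injective⇒surjective f-inj y))

  ⁻¹-inverseˡ : ∀ x → (f ⁻¹) (f x) ≡ x
  ⁻¹-inverseˡ x = f-inj _ _ (⁻¹-inverseʳ (f x))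

  ⁻¹-injective : IsInjective (f ⁻¹)
  ⁻¹-injective x y e = trans (sym (⁻¹-inverseʳ x)) (trans (cong f e) (⁻¹-inverseʳ y))

  toPermutation : Permutation′ n
  toPermutation = permutation f (f ⁻¹) ⁻¹-inverseʳ ⁻¹-inverseˡ

⁻¹-cong : ∀ {n} {f g : Fin n → Fin n} → IsInjective f → f ≗ g → f ⁻¹ ≗ g ⁻¹
⁻¹-cong {f = f} {g} f-inj f≗g y = f-inj _ _ (begin
  f ((f ⁻¹) y) ≡⟨ ⁻¹-inverseʳ f-inj y ⟩
  y            ≡⟨ ⁻¹-inverseʳ g-inj y ⟨
  g ((g ⁻¹) y) ≡⟨ f≗g _ ⟨
  f ((g ⁻¹) y) ∎)
  where
  open ≡-Reasoning
  g-inj : IsInjective g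
  g-inj i j gᵢ≡gⱼ = f-inj i j (trans (f≗g i) (trans gᵢ≡gⱼ (sym (f≗g j))))

∘-injective : ∀ {n} {f g : Fin n → Fin n} → IsInjective f → IsInjective g → IsInjective (f ∘ g)
∘-injective f-inj g-inj i j e = g-inj i j (f-inj _ _ e)

∏-reindex : ∀ {n} {g : Fin n → Fin n} → IsInjective g → (f : Fin n → Sign) → ∏ (f ∘ g) ≡ ∏ f
∏-reindex g-inj f = sym (∏-permute f (toPermutation g-inj))

prodSign-allFin : ∀ n (f : Fin n → Sign) → prodSign (map f (allFin n)) ≡ ∏ f
prodSign-allFin n f = trans (cong prodSign (ListP.map-tabulate id f)) (prodSign-tabulate n f)
  where
  prodSign-tabulate : ∀ n (f : Fin n → Sign) → prodSign (tabulate f) ≡ ∏ f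
  prodSign-tabulate zero    f = refl
  prodSign-tabulate (suc n) f = cong (f zero ·_) (prodSign-tabulate n (f ∘ suc))

prodSign-filter : ∀ {A : Set} {P : A → Set} (P? : ∀ x → Dec (P x)) (f : A → Sign) (xs : List A) →
  prodSign (map f (filter P? xs)) ≡ prodSign (map (λ x → signIf (does (P? x)) (f x)) xs)
prodSign-filter P? f []       = refl
prodSign-filter P? f (x ∷ xs) with P? x
... | yes _ = cong (f x ·_) (prodSign-filter P? f xs)
... | no _  = prodSign-filter P? f xs

opposite-·ˡ : ∀ s t → Sign.opposite (s · t) ≡ Sign.opposite s · t
opposite-·ˡ Sign.+ t = refl
opposite-·ˡ Sign.- t = SignP.opposite-involutive t

parity-suc : ∀ k → parity (suc k) ≡ Sign.opposite (parity k)
parity-suc zero          = refl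
parity-suc (suc zero)    = refl
parity-suc (suc (suc k)) = parity-suc k

parity-+ : ∀ m n → parity (m ℕ.+ n) ≡ parity m · parity n
parity-+ zero    n = refl
parity-+ (suc m) n = begin
  parity (suc (m ℕ.+ n))               ≡⟨ parity-suc (m ℕ.+ n) ⟩
  Sign.opposite (parity (m ℕ.+ n))     ≡⟨ cong Sign.opposite (parity-+ m n) ⟩
  Sign.opposite (parity m · parity n)  ≡⟨ opposite-·ˡ (parity m) (parity n) ⟩
  Sign.opposite (parity m) · parity n  ≡⟨ cong (_· parity n) (parity-suc m) ⟨
  parity (suc m) · parity n            ∎
  where open ≡-Reasoning

parity-length-concatMap : ∀ {A B : Set} (g : A → List B) (xs : List A) →
  parity (length (concatMap g xs)) ≡ prodSign (map (parity ∘ length ∘ g) xs)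
parity-length-concatMap g []       = refl
parity-length-concatMap g (x ∷ xs) = begin
  parity (length (g x ++ concatMap g xs))
    ≡⟨ cong parity (ListP.length-++ (g x)) ⟩
  parity (length (g x) ℕ.+ length (concatMap g xs))
    ≡⟨ parity-+ (length (g x)) _ ⟩
  parity (length (g x)) · parity (length (concatMap g xs))
    ≡⟨ cong (parity (length (g x)) ·_) (parity-length-concatMap g xs) ⟩
  parity (length (g x)) · prodSign (map (parity ∘ length ∘ g) xs) ∎
  where open ≡-Reasoning

parity-length-filter : ∀ {A : Set} {P : A → Set} (P? : ∀ x → Dec (P x)) (xs : List A) →
  parity (length (filter P? xs)) ≡ prodSign (map (negIf ∘ does ∘ P?) xs)
parity-length-filter P? []       = refl
parity-length-filter P? (x ∷ xs) with P? x
... | yes _ = trans (parity-suc (length (filter P? xs))) (cong Sign.opposite (parity-length-filter P? xs))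
... | no _  = parity-length-filter P? xs

-- The sign of a permutation

infix 7 _<ᵇ_
_<ᵇ_ : ∀ {n} → Fin n → Fin n → Bool
i <ᵇ j = does (toℕ i ℕP.<? toℕ j)

<ᵇ-irrefl : ∀ {n} (i : Fin n) → i <ᵇ i ≡ false
<ᵇ-irrefl i = dec-false (toℕ i ℕP.<? toℕ i) (ℕP.n≮n (toℕ i))

<ᵇ-flip : ∀ {n} {i j : Fin n} → i ≢ j → j <ᵇ i ≡ not (i <ᵇ j)
<ᵇ-flip {i = i} {j} i≢j with ℕP.<-cmp (toℕ i) (toℕ j)
... | tri< i<j _ j≮i
  rewrite dec-true (toℕ i ℕP.<? toℕ j) i<j | dec-false (toℕ j ℕP.<? toℕ i) j≮i = refl
... | tri≈ _ i≡j _ = ⊥-elim (i≢j (FinP.toℕ-injective i≡j))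
... | tri> i≮j _ j<i
  rewrite dec-false (toℕ i ℕP.<? toℕ j) i≮j | dec-true (toℕ j ℕP.<? toℕ i) j<i = refl

<ᵇ⇒≢ : ∀ {n} {i j : Fin n} → i <ᵇ j ≡ true → i ≢ j
<ᵇ⇒≢ {i = i} i<j refl with () ← trans (sym (<ᵇ-irrefl i)) i<j

<ᵇ-asym : ∀ {n} (i j : Fin n) → i <ᵇ j ∧ j <ᵇ i ≡ false
<ᵇ-asym i j with i FinP.≟ j
... | yes refl = cong (_∧ (i <ᵇ i)) (<ᵇ-irrefl i)
... | no i≢j   = trans (cong ((i <ᵇ j) ∧_) (<ᵇ-flip i≢j)) (BoolP.∧-inverseʳ (i <ᵇ j))

inversionSign : ∀ {n} → (Fin n → Fin n) → Fin n → Fin n → Sign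
inversionSign π i j = negIf (i <ᵇ j ∧ π j <ᵇ π i)

sgn-∏ : ∀ {n} (π : Fin n → Fin n) → sgn π ≡ ∏ λ i → ∏ λ j → inversionSign π i j
sgn-∏ {n} π = begin
  parity (length (concatMap inversionsFrom (allFin n)))
    ≡⟨ parity-length-concatMap inversionsFrom (allFin n) ⟩
  prodSign (map (parity ∘ length ∘ inversionsFrom) (allFin n))
    ≡⟨ prodSign-allFin n _ ⟩
  ∏ (λ i → parity (length (inversionsFrom i)))
    ≡⟨ ∏-cong (λ i → trans (parity-length-filter (inversion? π i) (allFin n))
                           (prodSign-allFin n (inversionSign π i))) ⟩
  ∏ (λ i → ∏ λ j → inversionSign π i j) ∎
  where
  open ≡-Reasoning
  inversionsFrom : Fin n → List (Fin n)
  inversionsFrom i = filter (inversion? π i) (allFin n)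

sgn-cong : ∀ {n} {f g : Fin n → Fin n} → f ≗ g → sgn f ≡ sgn g
sgn-cong {f = f} {g} f≗g = trans (sgn-∏ f) (trans (∏-cong λ i → ∏-cong λ j →
  cong₂ (λ x y → negIf (i <ᵇ j ∧ x <ᵇ y)) (f≗g j) (f≗g i)) (sym (sgn-∏ g)))

sgn-id : ∀ {n} → sgn {n} id ≡ Sign.+
sgn-id {n} = trans (sgn-∏ {n} id) (∏-trivial {n} {λ i → ∏ (inversionSign id i)} λ i →
  ∏-trivial {n} {inversionSign id i} λ j → cong negIf (<ᵇ-asym i j))

pairInversion : ∀ {n} → (Fin n → Fin n) → Fin n → Fin n → Sign
pairInversion σ a b = negIf (a <ᵇ b xor σ a <ᵇ σ b)

xor-not-not : ∀ x y → not x xor not y ≡ x xor y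
xor-not-not true  y = refl
xor-not-not false y = BoolP.not-involutive y

negIf-xor-cancel : ∀ x y → negIf y ≡ negIf x · negIf (x xor y)
negIf-xor-cancel true  true  = refl
negIf-xor-cancel true  false = refl
negIf-xor-cancel false y     = refl

-- A pair is inverted by σ ∘ π iff exactly one of π and σ (on the image pair) reverses it.
-- The σ-part, pairInversion σ, is symmetric, so by ∏-tournament its product over the pairs
-- {π i, π j} does not depend on how each pair is oriented, and is therefore sgn σ.
module _ {n} {σ : Fin n → Fin n} (σ-inj : IsInjective σ) where

  pairInversion-sym : ∀ a b → pairInversion σ a b ≡ pairInversion σ b a
  pairInversion-sym a b with a FinP.≟ b
  ... | yes refl = refl
  ... | no a≢b = cong negIf (begin
    a <ᵇ b xor σ a <ᵇ σ b             ≡⟨ xor-not-not (a <ᵇ b) _ ⟨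
    not (a <ᵇ b) xor not (σ a <ᵇ σ b) ≡⟨ cong₂ _xor_ (<ᵇ-flip a≢b) (<ᵇ-flip (a≢b ∘ σ-inj a b)) ⟨
    b <ᵇ a xor σ b <ᵇ σ a             ∎)
    where open ≡-Reasoning

  inversionSign-∘ : ∀ {π : Fin n → Fin n} → IsInjective π → ∀ i j →
    inversionSign (σ ∘ π) i j ≡ inversionSign π i j · signIf (i <ᵇ j) (pairInversion σ (π i) (π j))
  inversionSign-∘ {π} π-inj i j with i <ᵇ j in i<j
  ... | false = refl
  ... | true  = begin
    negIf y                               ≡⟨ negIf-xor-cancel x y ⟩
    negIf x · negIf (x xor y)             ≡⟨ cong (λ b → negIf x · negIf b) (xor-not-not x y) ⟨
    negIf x · negIf (not x xor not y)     ≡⟨ cong₂ (λ b c → negIf x · negIf (b xor c))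
                                                   (<ᵇ-flip πj≢πi) (<ᵇ-flip (πj≢πi ∘ σ-inj _ _)) ⟨
    negIf x · pairInversion σ (π i) (π j) ∎
    where
    open ≡-Reasoning
    x y : Bool
    x = π j <ᵇ π i
    y = σ (π j) <ᵇ σ (π i)
    πj≢πi : π j ≢ π i
    πj≢πi πj≡πi = <ᵇ⇒≢ i<j (π-inj i j (sym πj≡πi))

  inversionSign-as-pairInversion : ∀ a b → signIf (a <ᵇ b) (pairInversion σ a b) ≡ inversionSign σ a b
  inversionSign-as-pairInversion a b with a <ᵇ b in a<b
  ... | false = refl
  ... | true  = cong negIf (sym (<ᵇ-flip (<ᵇ⇒≢ a<b ∘ σ-inj a b)))

  sgn-as-pairInversions : ∀ {π : Fin n → Fin n} → IsInjective π →
    (∏ λ i → ∏ λ j → signIf (i <ᵇ j) (pairInversion σ (π i) (π j))) ≡ sgn σ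
  sgn-as-pairInversions {π} π-inj = begin
    (∏ λ i → ∏ λ j → signIf (i <ᵇ j) (W i j))
      ≡⟨ ∏-tournament _<ᵇ_ <ᵇ-irrefl <ᵇ-flip W W-sym ⟩
    ∏-pairs W
      ≡⟨ ∏-tournament (λ i j → π i <ᵇ π j) (<ᵇ-irrefl ∘ π) (λ i≢j → <ᵇ-flip (i≢j ∘ π-inj _ _))
                      W W-sym ⟨
    (∏ λ i → ∏ λ j → signIf (π i <ᵇ π j) (W i j))
      ≡⟨ ∏-cong (λ i → ∏-reindex π-inj (λ b → signIf (π i <ᵇ b) (pairInversion σ (π i) b))) ⟩
    (∏ λ i → ∏ λ b → signIf (π i <ᵇ b) (pairInversion σ (π i) b))
      ≡⟨ ∏-reindex π-inj (λ a → ∏ λ b → signIf (a <ᵇ b) (pairInversion σ a b)) ⟩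
    (∏ λ a → ∏ λ b → signIf (a <ᵇ b) (pairInversion σ a b))
      ≡⟨ ∏-cong (λ a → ∏-cong (inversionSign-as-pairInversion a)) ⟩
    (∏ λ a → ∏ λ b → inversionSign σ a b)
      ≡⟨ sgn-∏ σ ⟨
    sgn σ ∎
    where
    open ≡-Reasoning
    W : Fin n → Fin n → Sign
    W i j = pairInversion σ (π i) (π j)
    W-sym : ∀ i j → W i j ≡ W j i
    W-sym i j = pairInversion-sym (π i) (π j)

  sgn-∘ : ∀ {π : Fin n → Fin n} → IsInjective π → sgn (σ ∘ π) ≡ sgn σ · sgn π
  sgn-∘ {π} π-inj = begin
    sgn (σ ∘ π)                                         ≡⟨ sgn-∏ (σ ∘ π) ⟩
    (∏ λ i → ∏ λ j → inversionSign (σ ∘ π) i j)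
      ≡⟨ ∏-cong (λ i → ∏-cong (inversionSign-∘ π-inj i)) ⟩
    (∏ λ i → ∏ λ j → inversionSign π i j · J i j)       ≡⟨ ∏²-distrib (inversionSign π) J ⟩
    (∏ λ i → ∏ (inversionSign π i)) · (∏ λ i → ∏ (J i))
      ≡⟨ cong₂ _·_ (sym (sgn-∏ π)) (sgn-as-pairInversions π-inj) ⟩
    sgn π · sgn σ                                       ≡⟨ SignP.*-comm (sgn π) (sgn σ) ⟩
    sgn σ · sgn π                                       ∎
    where
    open ≡-Reasoning
    J : Fin n → Fin n → Sign
    J i j = signIf (i <ᵇ j) (pairInversion σ (π i) (π j))

sgn-⁻¹ : ∀ {n} {τ : Fin n → Fin n} → IsInjective τ → sgn (τ ⁻¹) ≡ sgn τ
sgn-⁻¹ {n} {τ} τ-inj = SignP.*-cancelʳ-≡ (sgn τ) _ _ (begin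
  sgn (τ ⁻¹) · sgn τ ≡⟨ sgn-∘ (⁻¹-injective τ-inj) τ-inj ⟨
  sgn (τ ⁻¹ ∘ τ)     ≡⟨ sgn-cong (⁻¹-inverseˡ τ-inj) ⟩
  sgn {n} id         ≡⟨ sgn-id {n} ⟩
  Sign.+             ≡⟨ SignP.s*s≡+ (sgn τ) ⟨
  sgn τ · sgn τ      ∎)
  where open ≡-Reasoning

module _ {n} (a b : Fin n) where

  transpose-ˡ : transpose a b a ≡ b
  transpose-ˡ rewrite dec-true (a FinP.≟ a) refl = refl

  transpose-ʳ : transpose a b b ≡ a
  transpose-ʳ with b FinP.≟ a
  ... | yes refl = refl
  ... | no _ rewrite dec-true (b FinP.≟ b) refl = refl

  transpose-≢ : ∀ {x} → x ≢ a → x ≢ b → transpose a b x ≡ x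
  transpose-≢ {x} x≢a x≢b rewrite dec-false (x FinP.≟ a) x≢a | dec-false (x FinP.≟ b) x≢b = refl

  data TransposeView (x : Fin n) : Fin n → Set where
    at-a  : x ≡ a → TransposeView x b
    at-b  : x ≢ a → x ≡ b → TransposeView x a
    fixed : x ≢ a → x ≢ b → TransposeView x x

  transpose-view : ∀ x → TransposeView x (transpose a b x)
  transpose-view x = view (x FinP.≟ a) (x FinP.≟ b)
    where
    view : Dec (x ≡ a) → Dec (x ≡ b) → TransposeView x (transpose a b x)
    view (yes refl) _          = subst (TransposeView x) (sym transpose-ˡ) (at-a refl)
    view (no x≢a)   (yes refl) = subst (TransposeView x) (sym transpose-ʳ) (at-b x≢a refl)
    view (no x≢a)   (no x≢b)   = subst (TransposeView x) (sym (transpose-≢ x≢a x≢b)) (fixed x≢a x≢b)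

  transpose-involutive : ∀ x → transpose a b (transpose a b x) ≡ x
  transpose-involutive x with transpose a b x | transpose-view x
  ... | _ | at-a refl     = transpose-ʳ
  ... | _ | at-b _ refl   = transpose-ˡ
  ... | _ | fixed x≢a x≢b = transpose-≢ x≢a x≢b

  transpose-injective : IsInjective (transpose a b)
  transpose-injective x y e =
    trans (sym (transpose-involutive x)) (trans (cong (transpose a b) e) (transpose-involutive y))

transpose-conjugate : ∀ {n} {β : Fin n → Fin n} → IsInjective β → ∀ a b x →
  transpose (β a) (β b) (β x) ≡ β (transpose a b x)
transpose-conjugate {β = β} β-inj a b x with transpose a b x | transpose-view a b x
... | _ | at-a refl     = transpose-ˡ (β x) (β b)
... | _ | at-b _ refl   = transpose-ʳ (β a) (β x)
... | _ | fixed x≢a x≢b = transpose-≢ (β a) (β b) (x≢a ∘ β-inj x a) (x≢b ∘ β-inj x b)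

sgn-transpose₀₁ : ∀ {m} → sgn (transpose {suc (suc m)} zero (suc zero)) ≡ Sign.-
sgn-transpose₀₁ {m} = trans (sgn-∏ τ) (cong₂ _·_ row₀ (cong₂ _·_ row₁ other-rows))
  where
  τ : Fin (suc (suc m)) → Fin (suc (suc m))
  τ = transpose zero (suc zero)
  row₀ : ∏ (inversionSign τ zero) ≡ Sign.-
  row₀ = cong (Sign.- ·_) (∏-trivial {m} {λ j → inversionSign τ zero (suc (suc j))} λ _ → refl)
  row₁ : ∏ (inversionSign τ (suc zero)) ≡ Sign.+
  row₁ = ∏-trivial {f = inversionSign τ (suc zero)}
    λ { zero → refl ; (suc zero) → refl ; (suc (suc _)) → refl }
  other-row : ∀ i → ∏ (inversionSign τ (suc (suc i))) ≡ Sign.+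
  other-row i = ∏-trivial {f = inversionSign τ (suc (suc i))}
    λ { zero → refl ; (suc zero) → refl ; (suc (suc j)) → cong negIf (<ᵇ-asym (suc (suc i)) (suc (suc j))) }
  other-rows : (∏ λ i → ∏ (inversionSign τ (suc (suc i)))) ≡ Sign.+
  other-rows = ∏-trivial {m} {λ i → ∏ (inversionSign τ (suc (suc i)))} other-row

-- Conjugation by β, which sends 0 to a and 1 to b, reduces to the transposition of 0 and 1.
sgn-transpose : ∀ {n} {a b : Fin n} → a ≢ b → sgn (transpose a b) ≡ Sign.-
sgn-transpose {zero}  {()}
sgn-transpose {suc zero} {zero} {zero} a≢b = ⊥-elim (a≢b refl)
sgn-transpose {suc (suc m)} {a} {b} a≢b = SignP.*-cancelʳ-≡ (sgn β) _ _ (begin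
  sgn (transpose a b) · sgn β ≡⟨ sgn-∘ (transpose-injective a b) β-inj ⟨
  sgn (transpose a b ∘ β)     ≡⟨ sgn-cong (λ x → trans (cong₂ (λ u v → transpose u v (β x)) (sym β₀) (sym β₁))
                                                           (transpose-conjugate β-inj zero (suc zero) x)) ⟩
  sgn (β ∘ τ₀₁)               ≡⟨ sgn-∘ β-inj (transpose-injective zero (suc zero)) ⟩
  sgn β · sgn τ₀₁             ≡⟨ cong (sgn β ·_) (sgn-transpose₀₁ {m}) ⟩
  sgn β · Sign.-              ≡⟨ SignP.*-comm (sgn β) Sign.- ⟩
  Sign.- · sgn β              ∎)
  where
  open ≡-Reasoning
  τ₀₁ β : Fin (suc (suc m)) → Fin (suc (suc m))
  τ₀₁ = transpose zero (suc zero)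
  c : Fin (suc (suc m))
  c = transpose zero a b
  β = transpose zero a ∘ transpose (suc zero) c
  β-inj : IsInjective β
  β-inj = ∘-injective (transpose-injective zero a) (transpose-injective (suc zero) c)
  β₁ : β (suc zero) ≡ b
  β₁ = trans (cong (transpose zero a) (transpose-ˡ (suc zero) c)) (transpose-involutive zero a b)
  c≢0 : zero ≢ c
  c≢0 0≡c = a≢b (trans (sym (transpose-ˡ zero a))
                       (trans (cong (transpose zero a) 0≡c) (transpose-involutive zero a b)))
  β₀ : β zero ≡ a
  β₀ = trans (cong (transpose zero a) (transpose-≢ (suc zero) c (λ ()) c≢0)) (transpose-ˡ zero a)

-- Cycles of a permutation

module Orbit {n} {π : Fin n → Fin n} (π-inj : IsInjective π) where

  iter-+ : ∀ a b x → iter π (a ℕ.+ b) x ≡ iter π a (iter π b x)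
  iter-+ zero    b x = refl
  iter-+ (suc a) b x = cong π (iter-+ a b x)

  iter-injective : ∀ k {x y} → iter π k x ≡ iter π k y → x ≡ y
  iter-injective zero    e = e
  iter-injective (suc k) e = iter-injective k (π-inj _ _ e)

  iter-periodic : ∀ {p x} → iter π p x ≡ x → ∀ m → iter π (m ℕ.* p) x ≡ x
  iter-periodic         eq zero    = refl
  iter-periodic {p} {x} eq (suc m) =
    trans (iter-+ p (m ℕ.* p) x) (trans (cong (iter π p) (iter-periodic eq m)) eq)

  period : ∀ x → ∃ λ q → q ℕ.< n × iter π (suc q) x ≡ x
  period x with FinP.pigeonhole (ℕP.n<1+n n) (λ (i : Fin (suc n)) → iter π (toℕ i) x)
  ... | i , j , i<j , iterᵢ≡iterⱼ = q , q<n , iter-injective (toℕ i) (begin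
    iter π (toℕ i) (iter π (suc q) x) ≡⟨ iter-+ (toℕ i) (suc q) x ⟨
    iter π (toℕ i ℕ.+ suc q) x        ≡⟨ cong (λ k → iter π k x) i+1+q≡j ⟩
    iter π (toℕ j) x                  ≡⟨ iterᵢ≡iterⱼ ⟨
    iter π (toℕ i) x                  ∎)
    where
    open ≡-Reasoning
    q : ℕ
    q = toℕ j ℕ.∸ suc (toℕ i)
    i+1+q≡j : toℕ i ℕ.+ suc q ≡ toℕ j
    i+1+q≡j = trans (ℕP.+-suc (toℕ i) q) (ℕP.m+[n∸m]≡n i<j)
    q<n : q ℕ.< n
    q<n = ℕP.≤-trans (ℕP.m≤n+m (suc q) (toℕ i))
                     (ℕP.≤-trans (ℕP.≤-reflexive i+1+q≡j) (ℕP.≤-pred (FinP.toℕ<n j)))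

  -- Reachability with an unbounded number of steps; it agrees with InOrbit, where the
  -- number of steps is below n, because every point returns to itself within n steps.
  infix 4 _↝_
  _↝_ : Fin n → Fin n → Set
  x ↝ y = ∃ λ k → iter π k x ≡ y

  ↝-refl : ∀ {x} → x ↝ x
  ↝-refl = 0 , refl

  ↝-step : ∀ x → x ↝ π x
  ↝-step x = 1 , refl

  ↝-trans : ∀ {x y z} → x ↝ y → y ↝ z → x ↝ z
  ↝-trans {x} (a , refl) (b , refl) = b ℕ.+ a , iter-+ b a x

  ↝-sym : ∀ {x y} → x ↝ y → y ↝ x
  ↝-sym {x} (k , refl) with period x
  ... | q , _ , cycle = k ℕ.* q , (begin
    iter π (k ℕ.* q) (iter π k x) ≡⟨ iter-+ (k ℕ.* q) k x ⟨
    iter π (k ℕ.* q ℕ.+ k) x      ≡⟨ cong (λ m → iter π m x) (trans (ℕP.+-comm (k ℕ.* q) k)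
                                                                    (sym (ℕP.*-suc k q))) ⟩
    iter π (k ℕ.* suc q) x        ≡⟨ iter-periodic cycle k ⟩
    x                             ∎)
    where open ≡-Reasoning

  ↝⇒InOrbit : ∀ {x y} → x ↝ y → InOrbit π x y
  ↝⇒InOrbit {x} (k , refl) with period x
  ... | q , q<n , cycle = fromℕ< r<n , (begin
    iter π (toℕ (fromℕ< r<n)) x                 ≡⟨ cong (λ m → iter π m x) (FinP.toℕ-fromℕ< r<n) ⟩
    iter π r x                                  ≡⟨ cong (iter π r) (iter-periodic cycle (k / suc q)) ⟨
    iter π r (iter π ((k / suc q) ℕ.* suc q) x) ≡⟨ iter-+ r _ x ⟨
    iter π (r ℕ.+ (k / suc q) ℕ.* suc q) x      ≡⟨ cong (λ m → iter π m x) (m≡m%n+[m/n]*n k (suc q)) ⟨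
    iter π k x                                  ∎)
    where
    open ≡-Reasoning
    r : ℕ
    r = k % suc q
    r<n : r ℕ.< n
    r<n = ℕP.<-≤-trans (m%n<n k (suc q)) q<n

  InOrbit⇒↝ : ∀ {x y} → InOrbit π x y → x ↝ y
  InOrbit⇒↝ (k , eq) = toℕ k , eq

  Leader : Fin n → Set
  Leader v = ∀ w → v ↝ w → toℕ v ℕ.≤ toℕ w

  IsLeader⇒Leader : ∀ {v} → IsLeader π v → Leader v
  IsLeader⇒Leader leads w v↝w = leads w (↝⇒InOrbit v↝w)

  Leader⇒IsLeader : ∀ {v} → Leader v → IsLeader π v
  Leader⇒IsLeader leads w inOrbit = leads w (InOrbit⇒↝ inOrbit)

module CycleLeader {n} {π : Fin n → Fin n} (π-inj : IsInjective π) where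
  open Orbit π-inj

  -- Descend through ever smaller points of the orbit until reaching one that leads it.
  leader-below : ∀ k {u y} → toℕ y ℕ.< k → u ↝ y → ∃ λ x → u ↝ x × Leader x
  leader-below (suc k) {u} {y} y<k+1 u↝y with isLeader? π y
  ... | yes y-leads = y , u↝y , IsLeader⇒Leader y-leads
  ... | no ¬y-leads
    with FinP.¬∀⟶∃¬ n _ (λ w → inOrbit? π y w →-dec (toℕ y ℕP.≤? toℕ w)) ¬y-leads
  ...   | w , ¬[y↝w⇒y≤w] with inOrbit? π y w
  ...     | no ¬y↝w = ⊥-elim (¬[y↝w⇒y≤w] (⊥-elim ∘ ¬y↝w))
  ...     | yes y↝w = leader-below k w<k (↝-trans u↝y (InOrbit⇒↝ y↝w))
    where
    w<k : toℕ w ℕ.< k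
    w<k = ℕP.<-≤-trans (ℕP.≰⇒> (¬[y↝w⇒y≤w] ∘ λ y≤w _ → y≤w)) (ℕP.≤-pred y<k+1)

  leader-exists : ∀ u → ∃ λ x → IsLeader π x × InOrbit π x u
  leader-exists u with leader-below (suc (toℕ u)) ℕP.≤-refl (↝-refl {u})
  ... | x , u↝x , x-leads = x , Leader⇒IsLeader x-leads , ↝⇒InOrbit (↝-sym u↝x)

  leader-unique : ∀ {u x y} → IsLeader π x → InOrbit π x u → IsLeader π y → InOrbit π y u → x ≡ y
  leader-unique x-leads x↝u y-leads y↝u = FinP.toℕ-injective (ℕP.≤-antisym
    (IsLeader⇒Leader x-leads _ (↝-trans (InOrbit⇒↝ x↝u) (↝-sym (InOrbit⇒↝ y↝u))))
    (IsLeader⇒Leader y-leads _ (↝-trans (InOrbit⇒↝ y↝u) (↝-sym (InOrbit⇒↝ x↝u)))))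

iter-fixed : ∀ {n} {π : Fin n → Fin n} {x} → π x ≡ x → ∀ k → iter π k x ≡ x
iter-fixed         πx≡x zero    = refl
iter-fixed {π = π} πx≡x (suc k) = trans (cong π (iter-fixed πx≡x k)) πx≡x

-- (-1) to the number of cycles of π, each cycle having exactly one leader (its least point).
cycleSign : ∀ {n} → (Fin n → Fin n) → Sign
cycleSign π = ∏ λ v → negIf (does (isLeader? π v))

-- For the largest point v moved by π, composing with the transposition of v and π v splits v
-- off its cycle as a fixed point: the leaders of ρ are those of π together with v.
module SplitOff {n} {π : Fin n → Fin n} (π-inj : IsInjective π) {b}
  (moved<b+1 : ∀ x → π x ≢ x → toℕ x ℕ.< suc b) {v} (v≡b : toℕ v ≡ b) (v-moved : π v ≢ v) where

  w : Fin n
  w = π v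

  ρ : Fin n → Fin n
  ρ = transpose v w ∘ π

  ρ-inj : IsInjective ρ
  ρ-inj = ∘-injective (transpose-injective v w) π-inj

  module P = Orbit π-inj
  module R = Orbit ρ-inj

  ρ-fixes-v : ρ v ≡ v
  ρ-fixes-v = transpose-ʳ v w

  moved-≢b⇒<b : ∀ {x} → π x ≢ x → x ≢ v → toℕ x ℕ.< b
  moved-≢b⇒<b {x} πx≢x x≢v = ℕP.≤∧≢⇒< (ℕP.m<1+n⇒m≤n (moved<b+1 x πx≢x))
                                      (λ x≡b → x≢v (FinP.toℕ-injective (trans x≡b (sym v≡b))))

  w<v : toℕ w ℕ.< toℕ v
  w<v = subst (toℕ w ℕ.<_) (sym v≡b) (moved-≢b⇒<b (v-moved ∘ π-inj _ _) v-moved)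

  ρ-step : ∀ z → z P.↝ transpose v w (π z)
  ρ-step z with transpose v w (π z) | transpose-view v w (π z)
  ... | _ | at-a πz≡v   = 2 , cong π πz≡v
  ... | _ | at-b _ πz≡w = 0 , π-inj z v πz≡w
  ... | _ | fixed _ _   = 1 , refl

  ρ↝⇒π↝ : ∀ {x y} → x R.↝ y → x P.↝ y
  ρ↝⇒π↝ (zero  , refl) = P.↝-refl
  ρ↝⇒π↝ (suc k , refl) = P.↝-trans (ρ↝⇒π↝ (k , refl)) (ρ-step _)

  ρ↝v⇒≡v : ∀ {x} → x R.↝ v → x ≡ v
  ρ↝v⇒≡v (k , ρᵏx≡v) = iterᵏ≡v k ρᵏx≡v
    where
    iterᵏ≡v : ∀ {x} k → iter ρ k x ≡ v → x ≡ v
    iterᵏ≡v zero    x≡v  = x≡v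
    iterᵏ≡v (suc k) ρy≡v = iterᵏ≡v k (ρ-inj _ _ (trans ρy≡v (sym ρ-fixes-v)))

  ρ-tracks-π : ∀ {x} → x ≢ v → ∀ k →
    x R.↝ iter π k x ⊎ (iter π k x ≡ v × ∃ λ z → x R.↝ z × π z ≡ v)
  ρ-tracks-π x≢v zero = inj₁ R.↝-refl
  ρ-tracks-π {x} x≢v (suc k) with ρ-tracks-π x≢v k
  ... | inj₂ (y≡v , z , x↝z , πz≡v) =
    inj₁ (R.↝-trans x↝z (1 , trans (cong (transpose v w) πz≡v)
                                    (trans (transpose-ˡ v w) (cong π (sym y≡v)))))
  ... | inj₁ x↝y with π (iter π k x) FinP.≟ v
  ...   | yes πy≡v = inj₂ (πy≡v , iter π k x , x↝y , πy≡v)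
  ...   | no πy≢v  = inj₁ (R.↝-trans x↝y (1 , transpose-≢ v w πy≢v πy≢w))
    where
    πy≢w : π (iter π k x) ≢ w
    πy≢w πy≡w = x≢v (ρ↝v⇒≡v (R.↝-trans x↝y (0 , π-inj _ _ πy≡w)))

  π↝⇒ρ↝ : ∀ {x y} → x ≢ v → y ≢ v → x P.↝ y → x R.↝ y
  π↝⇒ρ↝ x≢v y≢v (k , refl) with ρ-tracks-π x≢v k
  ... | inj₁ x↝y       = x↝y
  ... | inj₂ (y≡v , _) = ⊥-elim (y≢v y≡v)

  π-leader⇒ρ-leader : ∀ {u} → P.Leader u → R.Leader u
  π-leader⇒ρ-leader leads y u↝y = leads y (ρ↝⇒π↝ u↝y)

  ρ-leader⇒π-leader : ∀ {u} → u ≢ v → R.Leader u → P.Leader u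
  ρ-leader⇒π-leader {u} u≢v leads y u↝y with y FinP.≟ v
  ... | yes refl = subst (toℕ u ℕ.≤_) (sym v≡b) (ℕP.m<1+n⇒m≤n (moved<b+1 u u-moved))
    where
    u-moved : π u ≢ u
    u-moved πu≡u = u≢v (trans (sym (iter-fixed πu≡u (proj₁ u↝y))) (proj₂ u↝y))
  ... | no y≢v = leads y (π↝⇒ρ↝ u≢v y≢v u↝y)

  v-ρ-leader : R.Leader v
  v-ρ-leader y (k , v↝y) = ℕP.≤-reflexive (cong toℕ (trans (sym (iter-fixed ρ-fixes-v k)) v↝y))

  v-not-π-leader : ¬ P.Leader v
  v-not-π-leader leads = ℕP.<⇒≱ w<v (leads w (P.↝-step v))

  ρ-moved<b : ∀ x → ρ x ≢ x → toℕ x ℕ.< b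
  ρ-moved<b x ρx≢x with x FinP.≟ v
  ... | yes refl = ⊥-elim (ρx≢x ρ-fixes-v)
  ... | no x≢v   = moved-≢b⇒<b πx≢x x≢v
    where
    x≢w : π x ≡ x → x ≢ w
    x≢w πx≡x refl = v-moved (π-inj _ _ πx≡x)
    πx≢x : π x ≢ x
    πx≢x πx≡x = ρx≢x (trans (cong (transpose v w) πx≡x) (transpose-≢ v w x≢v (x≢w πx≡x)))

  leader-sign : ∀ u → negIf (does (isLeader? ρ u))
                    ≡ negIf (does (isLeader? π u)) · signIf (does (u FinP.≟ v)) Sign.-
  leader-sign u with u FinP.≟ v
  ... | yes refl
    rewrite dec-true (isLeader? ρ v) (R.Leader⇒IsLeader v-ρ-leader)
          | dec-false (isLeader? π v) (v-not-π-leader ∘ P.IsLeader⇒Leader) = refl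
  ... | no u≢v = trans (cong negIf (does-⇔ (mk⇔ to from) (isLeader? ρ u) (isLeader? π u)))
                       (sym (SignP.*-identityʳ _))
    where
    to : IsLeader ρ u → IsLeader π u
    to = P.Leader⇒IsLeader ∘ ρ-leader⇒π-leader u≢v ∘ R.IsLeader⇒Leader
    from : IsLeader π u → IsLeader ρ u
    from = R.Leader⇒IsLeader ∘ π-leader⇒ρ-leader ∘ P.IsLeader⇒Leader

  cycleSign-ρ : cycleSign ρ ≡ cycleSign π · Sign.-
  cycleSign-ρ = trans (∏-cong leader-sign) (trans (∏-distrib (λ u → negIf (does (isLeader? π u))) _)
    (cong (cycleSign π ·_) (∏-indicator v Sign.-)))

cycleSign-bounded : ∀ {n} b {π : Fin n → Fin n} → IsInjective π → (∀ x → π x ≢ x → toℕ x ℕ.< b) →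
  cycleSign π ≡ sgn π · ∏ {n} (λ _ → Sign.-)
cycleSign-bounded {n} zero {π} π-inj moved<0 = begin
  cycleSign π                  ≡⟨ ∏-cong (λ v → cong negIf (dec-true (isLeader? π v) (everyone-leads v))) ⟩
  ∏ {n} (λ _ → Sign.-)         ≡⟨ cong (_· ∏ {n} (λ _ → Sign.-)) (trans (sgn-cong π≗id) (sgn-id {n})) ⟨
  sgn π · ∏ {n} (λ _ → Sign.-) ∎
  where
  open ≡-Reasoning
  π≗id : ∀ x → π x ≡ x
  π≗id x with π x FinP.≟ x
  ... | yes πx≡x = πx≡x
  ... | no πx≢x  = ⊥-elim (ℕP.n≮0 (moved<0 x πx≢x))
  everyone-leads : ∀ v → IsLeader π v
  everyone-leads v w (k , πᵏv≡w) =
    ℕP.≤-reflexive (cong toℕ (trans (sym (iter-fixed (π≗id v) (toℕ k))) πᵏv≡w))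
cycleSign-bounded {n} (suc b) {π} π-inj moved<b+1
  with FinP.any? (λ x → (toℕ x ℕP.≟ b) ×-dec ¬? (π x FinP.≟ x))
... | no no-moved-b = cycleSign-bounded b π-inj moved<b
  where
  moved<b : ∀ x → π x ≢ x → toℕ x ℕ.< b
  moved<b x πx≢x =
    ℕP.≤∧≢⇒< (ℕP.m<1+n⇒m≤n (moved<b+1 x πx≢x)) (λ x≡b → no-moved-b (x , x≡b , πx≢x))
... | yes (v , v≡b , v-moved) = SignP.*-cancelʳ-≡ Sign.- _ _ (begin
  cycleSign π · Sign.-           ≡⟨ cycleSign-ρ ⟨
  cycleSign ρ                    ≡⟨ cycleSign-bounded b ρ-inj ρ-moved<b ⟩
  sgn ρ · N                      ≡⟨ cong (_· N) (sgn-∘ (transpose-injective v w) π-inj) ⟩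
  (sgn (transpose v w) · sgn π) · N
                                 ≡⟨ cong (λ s → (s · sgn π) · N) (sgn-transpose (v-moved ∘ sym)) ⟩
  (Sign.- · sgn π) · N           ≡⟨ solve 3 (λ m s t → (m ⊕ s) ⊕ t ⊜ (s ⊕ t) ⊕ m) refl _ (sgn π) N ⟩
  (sgn π · N) · Sign.-           ∎)
  where
  open ≡-Reasoning
  open SplitOff π-inj moved<b+1 v≡b v-moved
  N : Sign
  N = ∏ {n} (λ _ → Sign.-)

cycleSign≡sgn·parity : ∀ {n} {π : Fin n → Fin n} → IsInjective π →
  cycleSign π ≡ sgn π · ∏ {n} (λ _ → Sign.-)
cycleSign≡sgn·parity {n} π-inj = cycleSign-bounded n π-inj (λ x _ → FinP.toℕ<n x)

∏-over-cycles : ∀ {n} {π : Fin n → Fin n} → IsInjective π → (W : Fin n → Sign) →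
  (∏ λ x → signIf (does (isLeader? π x)) (prodSign (map W (filter (inOrbit? π x) (allFin n))))) ≡ ∏ W
∏-over-cycles {n} {π} π-inj W = begin
  (∏ λ x → signIf (does (isLeader? π x)) (prodSign (map W (filter (inOrbit? π x) (allFin n)))))
    ≡⟨ ∏-cong cycle-as-∏ ⟩
  (∏ λ x → ∏ λ u → G x u) ≡⟨ ∏-comm G ⟩
  (∏ λ u → ∏ λ x → G x u) ≡⟨ ∏-cong one-leader-per-vertex ⟩
  ∏ W ∎
  where
  open ≡-Reasoning
  open CycleLeader π-inj
  G : Fin n → Fin n → Sign
  G x u = signIf (does (isLeader? π x) ∧ does (inOrbit? π x u)) (W u)

  cycle-as-∏ : ∀ x → signIf (does (isLeader? π x)) (prodSign (map W (filter (inOrbit? π x) (allFin n))))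
                     ≡ ∏ (G x)
  cycle-as-∏ x = expand (isLeader? π x)
    where
    expand : (d : Dec (IsLeader π x)) →
      signIf (does d) (prodSign (map W (filter (inOrbit? π x) (allFin n))))
        ≡ ∏ (λ u → signIf (does d ∧ does (inOrbit? π x u)) (W u))
    expand (yes _) = trans (prodSign-filter (inOrbit? π x) W (allFin n)) (prodSign-allFin n _)
    expand (no _)  = sym (∏-trivial {n} {λ _ → Sign.+} λ _ → refl)

  one-leader-per-vertex : ∀ u → ∏ (λ x → G x u) ≡ W u
  one-leader-per-vertex u with leader-exists u
  ... | ℓ , ℓ-leads , ℓ↝u = trans (∏-cong only-ℓ) (∏-indicator ℓ (W u))
    where
    only-ℓ : ∀ x → G x u ≡ signIf (does (x FinP.≟ ℓ)) (W u)
    only-ℓ x = pick (x FinP.≟ ℓ) (isLeader? π x) (inOrbit? π x u)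
      where
      pick : (e : Dec (x ≡ ℓ)) (l : Dec (IsLeader π x)) (o : Dec (InOrbit π x u)) →
             signIf (does l ∧ does o) (W u) ≡ signIf (does e) (W u)
      pick (yes _)   (yes _)     (yes _)   = refl
      pick (yes x≡ℓ) (no ¬leads) _         = ⊥-elim (¬leads (subst (IsLeader π) (sym x≡ℓ) ℓ-leads))
      pick (yes x≡ℓ) (yes _)     (no ¬x↝u) = ⊥-elim (¬x↝u (subst (λ y → InOrbit π y u) (sym x≡ℓ) ℓ↝u))
      pick (no x≢ℓ)  (yes leads) (yes x↝u) = ⊥-elim (x≢ℓ (leader-unique leads x↝u ℓ-leads ℓ↝u))
      pick (no _)    (yes _)     (no _)    = refl
      pick (no _)    (no _)      _         = refl

negIf-positive : ∀ b s → negIf (b ∧ does (s Sign.≟ Sign.+)) ≡ negIf b · signIf b s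
negIf-positive true  Sign.+ = refl
negIf-positive true  Sign.- = refl
negIf-positive false s      = refl

contributorSign-as-sgn : ∀ {n} (H : SignMatrix n) (α : Permutation′ n) {π : Fin n → Fin n} → IsInjective π →
  contributorSign H α π ≡ sgn π · (∏ (λ u → H u (α ⟨$⟩ʳ u)) · ∏ (λ u → H (π u) (α ⟨$⟩ʳ u)))
contributorSign-as-sgn {n} H α {π} π-inj = begin
  parity (length (filter (positiveComponent? H α π) (allFin n)))
    ≡⟨ trans (parity-length-filter (positiveComponent? H α π) (allFin n)) (prodSign-allFin n _) ⟩
  ∏ (λ x → negIf (does (positiveComponent? H α π x)))
    ≡⟨ ∏-cong (λ x → negIf-positive (leads x) (componentSign H α π x)) ⟩
  ∏ (λ x → negIf (leads x) · signIf (leads x) (componentSign H α π x))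
    ≡⟨ ∏-distrib (negIf ∘ leads) _ ⟩
  cycleSign π · ∏ (λ x → signIf (leads x) (componentSign H α π x))
    ≡⟨ cong₂ _·_ (cycleSign≡sgn·parity π-inj) (∏-over-cycles π-inj step) ⟩
  (sgn π · ∏ {n} (λ _ → Sign.-)) · ∏ step
    ≡⟨ SignP.*-assoc (sgn π) _ _ ⟩
  sgn π · (∏ {n} (λ _ → Sign.-) · ∏ step)
    ≡⟨ cong (sgn π ·_) (∏-distrib (λ _ → Sign.-) step) ⟨
  sgn π · ∏ (λ u → Sign.- · step u)
    ≡⟨ cong (sgn π ·_) (∏-cong (λ u → SignP.opposite-involutive (H u (a u) · H (π u) (a u)))) ⟩
  sgn π · ∏ (λ u → H u (a u) · H (π u) (a u))
    ≡⟨ cong (sgn π ·_) (∏-distrib (λ u → H u (a u)) (λ u → H (π u) (a u))) ⟩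
  sgn π · (∏ (λ u → H u (a u)) · ∏ (λ u → H (π u) (a u))) ∎
  where
  open ≡-Reasoning
  a : Fin n → Fin n
  a = α ⟨$⟩ʳ_
  leads : Fin n → Bool
  leads x = does (isLeader? π x)
  step : Fin n → Sign
  step u = stepSign H u (a u) (π u)

𝟙 : Bool → ℤ
𝟙 true  = + 1
𝟙 false = + 0

𝟙-∧ : ∀ b c → 𝟙 (b ∧ c) ≡ 𝟙 b * 𝟙 c
𝟙-∧ true  true  = refl
𝟙-∧ true  false = refl
𝟙-∧ false c     = refl

∑ : {A : Set} → (A → ℤ) → List A → ℤ
∑ f xs = sumℤ (map f xs)

module _ {A : Set} where

  ∑-cong : ∀ {f g : A → ℤ} xs → f ≗ g → ∑ f xs ≡ ∑ g xs
  ∑-cong xs f≗g = cong sumℤ (ListP.map-cong f≗g xs)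

  ∑-zero : ∀ {f : A → ℤ} xs → (∀ x → f x ≡ + 0) → ∑ f xs ≡ + 0
  ∑-zero []       f≡0 = refl
  ∑-zero (x ∷ xs) f≡0 = cong₂ _+_ (f≡0 x) (∑-zero xs f≡0)

  ∑-++ : ∀ (f : A → ℤ) xs ys → ∑ f (xs ++ ys) ≡ ∑ f xs + ∑ f ys
  ∑-++ f []       ys = sym (ℤP.+-identityˡ _)
  ∑-++ f (x ∷ xs) ys = trans (cong (_+_ (f x)) (∑-++ f xs ys)) (sym (ℤP.+-assoc (f x) _ _))

  ∑-+ : ∀ (f g : A → ℤ) xs → ∑ (λ x → f x + g x) xs ≡ ∑ f xs + ∑ g xs
  ∑-+ f g []       = refl
  ∑-+ f g (x ∷ xs) = trans (cong (_+_ (f x + g x)) (∑-+ f g xs)) (middle-swap (f x) (g x) _ _)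
    where
    middle-swap : ∀ a b c d → a + b + (c + d) ≡ a + c + (b + d)
    middle-swap = solve-∀

  ∑-neg : ∀ (f : A → ℤ) xs → ∑ (λ x → - f x) xs ≡ - ∑ f xs
  ∑-neg f []       = refl
  ∑-neg f (x ∷ xs) = trans (cong (_+_ (- f x)) (∑-neg f xs)) (sym (ℤP.neg-distrib-+ (f x) _))

  ∑-*ˡ : ∀ c (f : A → ℤ) xs → ∑ (λ x → c * f x) xs ≡ c * ∑ f xs
  ∑-*ˡ c f []       = sym (ℤP.*-zeroʳ c)
  ∑-*ˡ c f (x ∷ xs) = trans (cong (_+_ (c * f x)) (∑-*ˡ c f xs)) (sym (ℤP.*-distribˡ-+ c (f x) _))

  ∑-*ʳ : ∀ c (f : A → ℤ) xs → ∑ (λ x → f x * c) xs ≡ ∑ f xs * c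
  ∑-*ʳ c f xs = trans (∑-cong xs (λ x → ℤP.*-comm (f x) c)) (trans (∑-*ˡ c f xs) (ℤP.*-comm c _))

  ∑-filter : ∀ {P : A → Set} (P? : ∀ x → Dec (P x)) (f : A → ℤ) xs →
    ∑ f (filter P? xs) ≡ ∑ (λ x → 𝟙 (does (P? x)) * f x) xs
  ∑-filter P? f []       = refl
  ∑-filter P? f (x ∷ xs) with P? x
  ... | yes _ = cong₂ _+_ (sym (ℤP.*-identityˡ (f x))) (∑-filter P? f xs)
  ... | no _  = trans (∑-filter P? f xs) (sym (ℤP.+-identityˡ _))

  ∑-cong-filter : ∀ {P : A → Set} (P? : ∀ x → Dec (P x)) {f g : A → ℤ} xs →
    (∀ x → P x → f x ≡ g x) → ∑ f (filter P? xs) ≡ ∑ g (filter P? xs)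
  ∑-cong-filter P? []       f≗g = refl
  ∑-cong-filter P? (x ∷ xs) f≗g with P? x
  ... | yes px = cong₂ _+_ (f≗g x px) (∑-cong-filter P? xs f≗g)
  ... | no _   = ∑-cong-filter P? xs f≗g

  length-filter : ∀ {P : A → Set} (P? : ∀ x → Dec (P x)) xs →
    + length (filter P? xs) ≡ ∑ (𝟙 ∘ does ∘ P?) xs
  length-filter P? []       = refl
  length-filter P? (x ∷ xs) with P? x
  ... | yes _ = cong (_+_ (+ 1)) (length-filter P? xs)
  ... | no _  = trans (length-filter P? xs) (sym (ℤP.+-identityˡ _))

∑-map : ∀ {A B : Set} (f : B → ℤ) (h : A → B) xs → ∑ f (map h xs) ≡ ∑ (f ∘ h) xs
∑-map f h xs = cong sumℤ (sym (ListP.map-∘ xs))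

∑-concatMap : ∀ {A B : Set} (f : B → ℤ) (g : A → List B) xs →
  ∑ f (concatMap g xs) ≡ ∑ (λ x → ∑ f (g x)) xs
∑-concatMap f g []       = refl
∑-concatMap f g (x ∷ xs) =
  trans (∑-++ f (g x) (concatMap g xs)) (cong (_+_ (∑ f (g x))) (∑-concatMap f g xs))

∑-comm : ∀ {A B : Set} (f : A → B → ℤ) xs ys →
  ∑ (λ x → ∑ (f x) ys) xs ≡ ∑ (λ y → ∑ (λ x → f x y) xs) ys
∑-comm f []       ys = sym (∑-zero ys (λ _ → refl))
∑-comm f (x ∷ xs) ys = trans (cong (_+_ (∑ (f x) ys)) (∑-comm f xs ys)) (sym (∑-+ (f x) _ ys))

∑-allFin-suc : ∀ {k} (f : Fin (suc k) → ℤ) → ∑ f (allFin (suc k)) ≡ f zero + ∑ (f ∘ suc) (allFin k)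
∑-allFin-suc {k} f = cong (_+_ (f zero)) (trans (cong sumℤ (ListP.map-tabulate suc f))
                                                (sym (cong sumℤ (ListP.map-tabulate id (f ∘ suc)))))

∑-indicator : ∀ {k} (y : Fin k) → ∑ (λ x → 𝟙 (does (x FinP.≟ y))) (allFin k) ≡ + 1
∑-indicator {suc k} zero    = trans (∑-allFin-suc {k} (λ x → 𝟙 (does (x FinP.≟ zero))))
                                    (cong (_+_ (+ 1)) (∑-zero (allFin k) λ _ → refl))
∑-indicator {suc k} (suc y) = trans (∑-allFin-suc {k} (λ x → 𝟙 (does (x FinP.≟ suc y))))
                                    (trans (ℤP.+-identityˡ _) (∑-indicator y))

∑-ones-allFin : ∀ n → ∑ (λ _ → + 1) (allFin n) ≡ + n
∑-ones-allFin n = trans (∑-ones (allFin n)) (cong +_ (ListP.length-tabulate {n = n} id))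
  where
  ∑-ones : ∀ {A : Set} (xs : List A) → ∑ (λ _ → + 1) xs ≡ + length xs
  ∑-ones []       = refl
  ∑-ones (x ∷ xs) = cong (_+_ (+ 1)) (∑-ones xs)

-- Counting injective functions

∑-allFuns-suc : ∀ m k (F : (Fin (suc m) → Fin k) → ℤ) →
  ∑ F (allFuns (suc m) k) ≡ ∑ (λ x → ∑ (λ g → F (x ∷ᶠ g)) (allFuns m k)) (allFin k)
∑-allFuns-suc m k F = trans (∑-concatMap F (λ x → map (x ∷ᶠ_) (allFuns m k)) (allFin k))
                            (∑-cong (allFin k) λ x → ∑-map F (x ∷ᶠ_) (allFuns m k))

_≗?_ : ∀ {m k} (f g : Fin m → Fin k) → Dec (f ≗ g)
f ≗? g = FinP.all? (λ i → f i FinP.≟ g i)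

≗?-∷ : ∀ {m k} (x : Fin k) (g : Fin m → Fin k) (h : Fin (suc m) → Fin k) →
  does ((x ∷ᶠ g) ≗? h) ≡ does (x FinP.≟ h zero) ∧ does (g ≗? (h ∘ suc))
≗?-∷ x g h = does-⇔ (mk⇔ (λ x∷g≗h → x∷g≗h zero , x∷g≗h ∘ suc) from)
  ((x ∷ᶠ g) ≗? h) ((x FinP.≟ h zero) ×-dec (g ≗? (h ∘ suc)))
  where
  from : x ≡ h zero × g ≗ h ∘ suc → (x ∷ᶠ g) ≗ h
  from (x≡h₀ , g≗h₊) zero    = x≡h₀
  from (x≡h₀ , g≗h₊) (suc i) = g≗h₊ i

count-≗ : ∀ m k (h : Fin m → Fin k) → ∑ (λ g → 𝟙 (does (g ≗? h))) (allFuns m k) ≡ + 1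
count-≗ zero    k h = refl
count-≗ (suc m) k h = begin
  ∑ (λ g → 𝟙 (does (g ≗? h))) (allFuns (suc m) k)
    ≡⟨ ∑-allFuns-suc m k _ ⟩
  ∑ (λ x → ∑ (λ g → 𝟙 (does ((x ∷ᶠ g) ≗? h))) (allFuns m k)) (allFin k)
    ≡⟨ ∑-cong (allFin k) (λ x → ∑-cong (allFuns m k) λ g →
         trans (cong 𝟙 (≗?-∷ x g h)) (𝟙-∧ (hit x) (does (g ≗? (h ∘ suc))))) ⟩
  ∑ (λ x → ∑ (λ g → 𝟙 (hit x) * 𝟙 (does (g ≗? (h ∘ suc)))) (allFuns m k)) (allFin k)
    ≡⟨ ∑-cong (allFin k) (λ x → trans (∑-*ˡ (𝟙 (hit x)) _ (allFuns m k))
         (trans (cong (𝟙 (hit x) *_) (count-≗ m k (h ∘ suc))) (ℤP.*-identityʳ _))) ⟩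
  ∑ (λ x → 𝟙 (hit x)) (allFin k)
    ≡⟨ ∑-indicator (h zero) ⟩
  + 1 ∎
  where
  open ≡-Reasoning
  hit : Fin k → Bool
  hit x = does (x FinP.≟ h zero)

-- IsInjective for maps between different Fin types; for m = k it is IsInjective itself.
IsInjective′ : ∀ {m k} → (Fin m → Fin k) → Set
IsInjective′ {m} f = ∀ (i j : Fin m) → f i ≡ f j → i ≡ j

injective′? : ∀ {m k} (f : Fin m → Fin k) → Dec (IsInjective′ f)
injective′? f = FinP.all? λ i → FinP.all? λ j → (f i FinP.≟ f j) →-dec (i FinP.≟ j)

∉-image? : ∀ {m k} (g : Fin m → Fin k) (x : Fin k) → Dec (∀ i → g i ≢ x)
∉-image? g x = FinP.all? (λ i → ¬? (g i FinP.≟ x))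

injective′?-∷ : ∀ {m k} (x : Fin k) (g : Fin m → Fin k) →
  does (injective′? (x ∷ᶠ g)) ≡ does (injective′? g) ∧ does (∉-image? g x)
injective′?-∷ x g = does-⇔ (mk⇔ to from) (injective′? (x ∷ᶠ g)) (injective′? g ×-dec ∉-image? g x)
  where
  to : IsInjective′ (x ∷ᶠ g) → IsInjective′ g × (∀ i → g i ≢ x)
  to inj = (λ i j gᵢ≡gⱼ → FinP.suc-injective (inj (suc i) (suc j) gᵢ≡gⱼ))
         , (λ i gᵢ≡x → FinP.0≢1+n (sym (inj (suc i) zero gᵢ≡x)))
  from : IsInjective′ g × (∀ i → g i ≢ x) → IsInjective′ (x ∷ᶠ g)
  from (g-inj , x∉g) zero    zero    _  = refl
  from (g-inj , x∉g) zero    (suc j) eq = ⊥-elim (x∉g j (sym eq))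
  from (g-inj , x∉g) (suc i) zero    eq = ⊥-elim (x∉g i eq)
  from (g-inj , x∉g) (suc i) (suc j) eq = cong suc (g-inj i j eq)

𝟙-none : ∀ {m} {P : Fin m → Set} (P? : ∀ i → Dec (P i)) → (∀ {i j} → P i → P j → i ≡ j) →
  𝟙 (does (FinP.all? (¬? ∘ P?))) ≡ + 1 - ∑ (𝟙 ∘ does ∘ P?) (allFin m)
𝟙-none {m} {P} P? unique with FinP.any? P?
... | yes (i₀ , Pi₀) rewrite dec-false (FinP.all? (¬? ∘ P?)) (λ none → none i₀ Pi₀) = begin
  + 0                                               ≡⟨ ℤP.+-inverseʳ (+ 1) ⟨
  + 1 - + 1                                         ≡⟨ cong (_-_ (+ 1)) (∑-indicator i₀) ⟨
  + 1 - ∑ (λ i → 𝟙 (does (i FinP.≟ i₀))) (allFin m) ≡⟨ cong (_-_ (+ 1)) (∑-cong (allFin m) (cong 𝟙 ∘ P⇔≡i₀)) ⟩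
  + 1 - ∑ (𝟙 ∘ does ∘ P?) (allFin m)                ∎
  where
  open ≡-Reasoning
  P⇔≡i₀ : ∀ i → does (i FinP.≟ i₀) ≡ does (P? i)
  P⇔≡i₀ i = does-⇔ (mk⇔ (λ i≡i₀ → subst P (sym i≡i₀) Pi₀) (λ Pi → unique Pi Pi₀)) (i FinP.≟ i₀) (P? i)
... | no ¬∃P rewrite dec-true (FinP.all? (¬? ∘ P?)) (λ i Pi → ¬∃P (i , Pi)) =
  sym (cong (_-_ (+ 1)) (∑-zero (allFin m) λ i → cong 𝟙 (dec-false (P? i) (λ Pi → ¬∃P (i , Pi)))))

count-∉image : ∀ {m k} (g : Fin m → Fin k) → IsInjective′ g →
  ∑ (𝟙 ∘ does ∘ ∉-image? g) (allFin k) ≡ + k - + m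
count-∉image {m} {k} g g-inj = begin
  ∑ (𝟙 ∘ does ∘ ∉-image? g) (allFin k)
    ≡⟨ ∑-cong (allFin k) (λ x → 𝟙-none (λ i → g i FinP.≟ x) (λ gᵢ≡x gⱼ≡x → g-inj _ _ (trans gᵢ≡x (sym gⱼ≡x)))) ⟩
  ∑ (λ x → + 1 - hits x) (allFin k)
    ≡⟨ ∑-+ (λ _ → + 1) (λ x → - hits x) (allFin k) ⟩
  ∑ (λ _ → + 1) (allFin k) + ∑ (λ x → - hits x) (allFin k)
    ≡⟨ cong₂ _+_ (∑-ones-allFin k) (∑-neg hits (allFin k)) ⟩
  + k - ∑ hits (allFin k)
    ≡⟨ cong (_-_ (+ k)) (∑-comm (λ x i → 𝟙 (does (g i FinP.≟ x))) (allFin k) (allFin m)) ⟩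
  + k - ∑ (λ i → ∑ (λ x → 𝟙 (does (g i FinP.≟ x))) (allFin k)) (allFin m)
    ≡⟨ cong (_-_ (+ k)) (∑-cong (allFin m) λ i → trans (∑-cong (allFin k) λ x →
         cong 𝟙 (does-⇔ (mk⇔ sym sym) (g i FinP.≟ x) (x FinP.≟ g i))) (∑-indicator (g i))) ⟩
  + k - ∑ (λ _ → + 1) (allFin m)
    ≡⟨ cong (_-_ (+ k)) (∑-ones-allFin m) ⟩
  + k - + m ∎
  where
  open ≡-Reasoning
  hits : Fin k → ℤ
  hits x = ∑ (λ i → 𝟙 (does (g i FinP.≟ x))) (allFin m)

falling : ℕ → ℕ → ℤ
falling k zero    = + 1
falling k (suc m) = falling k m * (+ k - + m)

count-injective : ∀ m k → ∑ (𝟙 ∘ does ∘ injective′?) (allFuns m k) ≡ falling k m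
count-injective zero    k = refl
count-injective (suc m) k = begin
  ∑ (𝟙 ∘ does ∘ injective′?) (allFuns (suc m) k)
    ≡⟨ ∑-allFuns-suc m k _ ⟩
  ∑ (λ x → ∑ (λ g → 𝟙 (does (injective′? (x ∷ᶠ g)))) (allFuns m k)) (allFin k)
    ≡⟨ ∑-cong (allFin k) (λ x → ∑-cong (allFuns m k) λ g →
         trans (cong 𝟙 (injective′?-∷ x g)) (𝟙-∧ (does (injective′? g)) _)) ⟩
  ∑ (λ x → ∑ (λ g → inj g * free g x) (allFuns m k)) (allFin k)
    ≡⟨ ∑-comm (λ x g → inj g * free g x) (allFin k) (allFuns m k) ⟩
  ∑ (λ g → ∑ (λ x → inj g * free g x) (allFin k)) (allFuns m k)
    ≡⟨ ∑-cong (allFuns m k) (λ g → trans (∑-*ˡ (inj g) (free g) (allFin k))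
                                         (count-free g (injective′? g))) ⟩
  ∑ (λ g → inj g * (+ k - + m)) (allFuns m k)
    ≡⟨ ∑-*ʳ (+ k - + m) inj (allFuns m k) ⟩
  ∑ inj (allFuns m k) * (+ k - + m)
    ≡⟨ cong (_* (+ k - + m)) (count-injective m k) ⟩
  falling k (suc m) ∎
  where
  open ≡-Reasoning
  inj : (Fin m → Fin k) → ℤ
  inj g = 𝟙 (does (injective′? g))
  free : (Fin m → Fin k) → Fin k → ℤ
  free g x = 𝟙 (does (∉-image? g x))
  count-free : ∀ g (d : Dec (IsInjective′ g)) →
    𝟙 (does d) * ∑ (free g) (allFin k) ≡ 𝟙 (does d) * (+ k - + m)
  count-free g (yes g-inj) = cong (+ 1 *_) (count-∉image g g-inj)
  count-free g (no _)      = refl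

falling-suc : ∀ k m → falling (suc k) (suc m) ≡ + suc k * falling k m
falling-suc k zero    =
  trans (ℤP.*-identityˡ _) (trans (ℤP.+-identityʳ (+ suc k)) (sym (ℤP.*-identityʳ _)))
falling-suc k (suc m) = begin
  falling (suc k) (suc m) * (+ suc k - + suc m) ≡⟨ cong₂ _*_ (falling-suc k m) 1+k-1+m≡k-m ⟩
  + suc k * falling k m * (+ k - + m)           ≡⟨ ℤP.*-assoc (+ suc k) (falling k m) _ ⟩
  + suc k * falling k (suc m)                   ∎
  where
  open ≡-Reasoning
  1+k-1+m≡k-m : + suc k - + suc m ≡ + k - + m
  1+k-1+m≡k-m = trans (ℤP.[1+m]⊖[1+n]≡m⊖n k m) (sym (ℤP.m-n≡m⊖n k m))

falling-n-n : ∀ n → falling n n ≡ + (n !)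
falling-n-n zero    = refl
falling-n-n (suc n) = begin
  falling (suc n) (suc n) ≡⟨ falling-suc n n ⟩
  + suc n * falling n n   ≡⟨ cong (+ suc n *_) (falling-n-n n) ⟩
  + suc n * + (n !)       ≡⟨ ℤP.pos-* (suc n) (n !) ⟨
  + (suc n !)             ∎
  where open ≡-Reasoning

length-perms : ∀ n → length (perms n) ≡ n !
length-perms n = ℤP.+-injective (begin
  + length (perms n)                      ≡⟨ length-filter injective? (allFuns n n) ⟩
  ∑ (𝟙 ∘ does ∘ injective′?) (allFuns n n) ≡⟨ count-injective n n ⟩
  falling n n                             ≡⟨ falling-n-n n ⟩
  + (n !)                                 ∎)
  where open ≡-Reasoning

-- Φ f is only pointwise equal to a member of allFuns n n, so the sum is not reindexed along
-- the list: instead Φ f is replaced by the sum over all g of [g ≗ Φ f] X g (count-≗), the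
-- double sum is swapped, and [g ≗ Φ f] is traded for [f ≗ Ψ g].
module ReindexPerms {n} (X : (Fin n → Fin n) → ℤ) (X-cong : ∀ {f g} → f ≗ g → X f ≡ X g)
  (Φ Ψ : (Fin n → Fin n) → (Fin n → Fin n))
  (Φ-inj  : ∀ {f} → IsInjective f → IsInjective (Φ f))
  (Ψ-inj  : ∀ {f} → IsInjective f → IsInjective (Ψ f))
  (Φ-cong : ∀ {f g} → IsInjective f → f ≗ g → Φ f ≗ Φ g)
  (Ψ-cong : ∀ {f g} → IsInjective f → f ≗ g → Ψ f ≗ Ψ g)
  (ΨΦ≗id  : ∀ {f} → IsInjective f → Ψ (Φ f) ≗ f)
  (ΦΨ≗id  : ∀ {f} → IsInjective f → Φ (Ψ f) ≗ f) where

  private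
    all : List (Fin n → Fin n)
    all = allFuns n n

    inj : (Fin n → Fin n) → ℤ
    inj f = 𝟙 (does (injective? f))

    eq : (Fin n → Fin n) → (Fin n → Fin n) → ℤ
    eq g h = 𝟙 (does (g ≗? h))

    injective-≗ : ∀ {f g : Fin n → Fin n} → IsInjective f → g ≗ f → IsInjective g
    injective-≗ f-inj g≗f i j gᵢ≡gⱼ = f-inj i j (trans (sym (g≗f i)) (trans gᵢ≡gⱼ (g≗f j)))

    ≗-sym : ∀ {f g : Fin n → Fin n} → f ≗ g → g ≗ f
    ≗-sym f≗g i = sym (f≗g i)

    inj·eq-swap : ∀ f g → inj f * eq g (Φ f) ≡ inj g * eq f (Ψ g)
    inj·eq-swap f g = trans (sym (𝟙-∧ (does (injective? f)) _))
      (trans (cong 𝟙 (does-⇔ (mk⇔ to from) (injective? f ×-dec (g ≗? Φ f))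
                                            (injective? g ×-dec (f ≗? Ψ g))))
             (𝟙-∧ (does (injective? g)) _))
      where
      to : IsInjective f × g ≗ Φ f → IsInjective g × f ≗ Ψ g
      to (f-inj , g≗Φf) = injective-≗ (Φ-inj f-inj) g≗Φf
                        , λ i → trans (sym (ΨΦ≗id f-inj i)) (Ψ-cong (Φ-inj f-inj) (≗-sym g≗Φf) i)
      from : IsInjective g × f ≗ Ψ g → IsInjective f × g ≗ Φ f
      from (g-inj , f≗Ψg) = injective-≗ (Ψ-inj g-inj) f≗Ψg
                          , λ i → trans (sym (ΦΨ≗id g-inj i)) (Φ-cong (Ψ-inj g-inj) (≗-sym f≗Ψg) i)

    single-out : ∀ f → inj f * X (Φ f) ≡ ∑ (λ g → (inj f * eq g (Φ f)) * X g) all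
    single-out f = expand (injective? f)
      where
      expand : (d : Dec (IsInjective f)) →
        𝟙 (does d) * X (Φ f) ≡ ∑ (λ g → (𝟙 (does d) * eq g (Φ f)) * X g) all
      expand (no _)  = sym (∑-zero all λ _ → refl)
      expand (yes _) = begin
        + 1 * X (Φ f)                          ≡⟨ ℤP.*-identityˡ _ ⟩
        X (Φ f)                                ≡⟨ ℤP.*-identityˡ _ ⟨
        + 1 * X (Φ f)                          ≡⟨ cong (_* X (Φ f)) (count-≗ n n (Φ f)) ⟨
        ∑ (λ g → eq g (Φ f)) all * X (Φ f)     ≡⟨ ∑-*ʳ (X (Φ f)) (λ g → eq g (Φ f)) all ⟨
        ∑ (λ g → eq g (Φ f) * X (Φ f)) all     ≡⟨ ∑-cong all (λ g → at-Φf g (g ≗? Φ f)) ⟩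
        ∑ (λ g → (+ 1 * eq g (Φ f)) * X g) all ∎
        where
        open ≡-Reasoning
        at-Φf : ∀ g (e : Dec (g ≗ Φ f)) → 𝟙 (does e) * X (Φ f) ≡ (+ 1 * 𝟙 (does e)) * X g
        at-Φf g (yes g≗Φf) = cong (+ 1 *_) (X-cong (≗-sym g≗Φf))
        at-Φf g (no _)     = refl

  ∑-perms-reindex : ∑ (X ∘ Φ) (perms n) ≡ ∑ X (perms n)
  ∑-perms-reindex = begin
    ∑ (X ∘ Φ) (perms n)                                    ≡⟨ ∑-filter injective? (X ∘ Φ) all ⟩
    ∑ (λ f → inj f * X (Φ f)) all                          ≡⟨ ∑-cong all single-out ⟩
    ∑ (λ f → ∑ (λ g → (inj f * eq g (Φ f)) * X g) all) all ≡⟨ ∑-comm _ all all ⟩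
    ∑ (λ g → ∑ (λ f → (inj f * eq g (Φ f)) * X g) all) all
      ≡⟨ ∑-cong all (λ g → ∑-*ʳ (X g) (λ f → inj f * eq g (Φ f)) all) ⟩
    ∑ (λ g → ∑ (λ f → inj f * eq g (Φ f)) all * X g) all   ≡⟨ ∑-cong all (λ g → cong (_* X g) (count-preimages g)) ⟩
    ∑ (λ g → inj g * X g) all                              ≡⟨ ∑-filter injective? X all ⟨
    ∑ X (perms n)                                          ∎
    where
    open ≡-Reasoning
    count-preimages : ∀ g → ∑ (λ f → inj f * eq g (Φ f)) all ≡ inj g
    count-preimages g = begin
      ∑ (λ f → inj f * eq g (Φ f)) all   ≡⟨ ∑-cong all (λ f → inj·eq-swap f g) ⟩
      ∑ (λ f → inj g * eq f (Ψ g)) all   ≡⟨ ∑-*ˡ (inj g) (λ f → eq f (Ψ g)) all ⟩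
      inj g * ∑ (λ f → eq f (Ψ g)) all   ≡⟨ cong (inj g *_) (count-≗ n n (Ψ g)) ⟩
      inj g * + 1                        ≡⟨ ℤP.*-identityʳ (inj g) ⟩
      inj g                              ∎

-- The contributor sum is ± det H

signToℤ-· : ∀ s t → signToℤ (s · t) ≡ signToℤ s * signToℤ t
signToℤ-· Sign.+ Sign.+ = refl
signToℤ-· Sign.+ Sign.- = refl
signToℤ-· Sign.- Sign.+ = refl
signToℤ-· Sign.- Sign.- = refl

prodℤ-signToℤ : ∀ {A : Set} (f : A → Sign) xs →
  prodℤ (map (signToℤ ∘ f) xs) ≡ signToℤ (prodSign (map f xs))
prodℤ-signToℤ f []       = refl
prodℤ-signToℤ f (x ∷ xs) =
  trans (cong (signToℤ (f x) *_) (prodℤ-signToℤ f xs)) (sym (signToℤ-· (f x) _))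

∣signToℤ*∣ : ∀ s i → ∣ signToℤ s * i ∣ ≡ ∣ i ∣
∣signToℤ*∣ Sign.+ i = cong ∣_∣ (ℤP.*-identityˡ i)
∣signToℤ*∣ Sign.- i = trans (cong ∣_∣ (ℤP.-1*i≡-i i)) (ℤP.∣-i∣≡∣i∣ i)

module ContributorSum {n} (H : SignMatrix n) (α : Permutation′ n) where

  a : Fin n → Fin n
  a = α ⟨$⟩ʳ_

  a-inj : IsInjective a
  a-inj i j aᵢ≡aⱼ = trans (sym (inverseˡ α)) (trans (cong (α ⟨$⟩ˡ_) aᵢ≡aⱼ) (inverseˡ α))

  diagonalSign : Sign
  diagonalSign = ∏ λ u → H u (a u)

  leibnizTerm : (Fin n → Fin n) → ℤ
  leibnizTerm τ = signToℤ (sgn τ · ∏ λ i → H i (τ i))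

  permutedTerm : (Fin n → Fin n) → ℤ
  permutedTerm π = signToℤ (sgn π · ∏ λ u → H (π u) (a u))

  det-as-∑ : det H ≡ ∑ leibnizTerm (perms n)
  det-as-∑ = ∑-cong (perms n) λ τ → begin
    signToℤ (sgn τ) * prodℤ (map (λ i → signToℤ (H i (τ i))) (allFin n))
      ≡⟨ cong (signToℤ (sgn τ) *_) (trans (prodℤ-signToℤ (λ i → H i (τ i)) (allFin n))
                                           (cong signToℤ (prodSign-allFin n _))) ⟩
    signToℤ (sgn τ) * signToℤ (∏ λ i → H i (τ i))
      ≡⟨ signToℤ-· (sgn τ) _ ⟨
    leibnizTerm τ ∎
    where open ≡-Reasoning

  contributor-as-permuted : ∀ {π} → IsInjective π →
    signToℤ (contributorSign H α π) ≡ signToℤ diagonalSign * permutedTerm π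
  contributor-as-permuted {π} π-inj = trans (cong signToℤ (trans (contributorSign-as-sgn H α π-inj)
    (solve 3 (λ s d w → s ⊕ (d ⊕ w) ⊜ d ⊕ (s ⊕ w)) refl (sgn π) diagonalSign _)))
    (signToℤ-· diagonalSign _)

  -- The substitution π = τ⁻¹ ∘ α turns permutedTerm into the Leibniz term of τ, up to sgn α.
  Φ Ψ : (Fin n → Fin n) → (Fin n → Fin n)
  Φ τ = τ ⁻¹ ∘ a
  Ψ π = a ∘ π ⁻¹

  permuted-Φ : ∀ {τ} → IsInjective τ → permutedTerm (Φ τ) ≡ signToℤ (sgn a) * leibnizTerm τ
  permuted-Φ {τ} τ-inj = trans (cong signToℤ (cong₂ _·_ sgn-Φ weight-Φ))
    (trans (cong signToℤ (SignP.*-assoc (sgn a) (sgn τ) _)) (signToℤ-· (sgn a) _))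
    where
    sgn-Φ : sgn (τ ⁻¹ ∘ a) ≡ sgn a · sgn τ
    sgn-Φ = trans (sgn-∘ (⁻¹-injective τ-inj) a-inj)
                  (trans (cong (_· sgn a) (sgn-⁻¹ τ-inj)) (SignP.*-comm (sgn τ) _))
    weight-Φ : (∏ λ u → H ((τ ⁻¹) (a u)) (a u)) ≡ ∏ λ i → H i (τ i)
    weight-Φ = begin
      (∏ λ u → H ((τ ⁻¹) (a u)) (a u)) ≡⟨ ∏-reindex a-inj (λ j → H ((τ ⁻¹) j) j) ⟩
      (∏ λ j → H ((τ ⁻¹) j) j)         ≡⟨ ∏-reindex τ-inj (λ j → H ((τ ⁻¹) j) j) ⟨
      (∏ λ i → H ((τ ⁻¹) (τ i)) (τ i)) ≡⟨ ∏-cong (λ i → cong (λ x → H x (τ i)) (⁻¹-inverseˡ τ-inj i)) ⟩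
      (∏ λ i → H i (τ i))              ∎
      where open ≡-Reasoning

  Φ-inj : ∀ {f} → IsInjective f → IsInjective (Φ f)
  Φ-inj f-inj = ∘-injective (⁻¹-injective f-inj) a-inj

  Ψ-inj : ∀ {f} → IsInjective f → IsInjective (Ψ f)
  Ψ-inj f-inj = ∘-injective a-inj (⁻¹-injective f-inj)

  ΨΦ≗id : ∀ {f} → IsInjective f → Ψ (Φ f) ≗ f
  ΨΦ≗id {f} f-inj x = trans (sym (⁻¹-inverseʳ f-inj _)) (cong f (⁻¹-inverseʳ (Φ-inj f-inj) x))

  ΦΨ≗id : ∀ {f} → IsInjective f → Φ (Ψ f) ≗ f
  ΦΨ≗id {f} f-inj x =
    trans (cong (Ψ f ⁻¹) (cong a (sym (⁻¹-inverseˡ f-inj x)))) (⁻¹-inverseˡ (Ψ-inj f-inj) (f x))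

  open ReindexPerms permutedTerm
    (λ f≗g → cong signToℤ (cong₂ _·_ (sgn-cong f≗g) (∏-cong (λ u → cong (λ x → H x (a u)) (f≗g u)))))
    Φ Ψ Φ-inj Ψ-inj
    (λ f-inj f≗g x → ⁻¹-cong f-inj f≗g (a x)) (λ f-inj f≗g x → cong a (⁻¹-cong f-inj f≗g x))
    ΨΦ≗id ΦΨ≗id

  contributorSum≡±det : contributorSum H α ≡ signToℤ diagonalSign * (signToℤ (sgn a) * det H)
  contributorSum≡±det = begin
    ∑ (signToℤ ∘ contributorSign H α) (perms n)
      ≡⟨ ∑-cong-filter injective? (allFuns n n) (λ π → contributor-as-permuted) ⟩
    ∑ (λ π → signToℤ diagonalSign * permutedTerm π) (perms n)
      ≡⟨ ∑-*ˡ (signToℤ diagonalSign) permutedTerm (perms n) ⟩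
    signToℤ diagonalSign * ∑ permutedTerm (perms n)
      ≡⟨ cong (signToℤ diagonalSign *_) (sym ∑-perms-reindex) ⟩
    signToℤ diagonalSign * ∑ (permutedTerm ∘ Φ) (perms n)
      ≡⟨ cong (signToℤ diagonalSign *_) (∑-cong-filter injective? (allFuns n n) (λ τ → permuted-Φ)) ⟩
    signToℤ diagonalSign * ∑ (λ τ → signToℤ (sgn a) * leibnizTerm τ) (perms n)
      ≡⟨ cong (signToℤ diagonalSign *_) (∑-*ˡ (signToℤ (sgn a)) leibnizTerm (perms n)) ⟩
    signToℤ diagonalSign * (signToℤ (sgn a) * ∑ leibnizTerm (perms n))
      ≡⟨ cong (λ d → signToℤ diagonalSign * (signToℤ (sgn a) * d)) det-as-∑ ⟨
    signToℤ diagonalSign * (signToℤ (sgn a) * det H) ∎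
    where open ≡-Reasoning

∣contributorSum∣≡∣det∣ : ∀ {n} (H : SignMatrix n) (α : Permutation′ n) →
  ∣ contributorSum H α ∣ ≡ ∣ det H ∣
∣contributorSum∣≡∣det∣ H α = trans (cong ∣_∣ contributorSum≡±det)
  (trans (∣signToℤ*∣ diagonalSign _) (∣signToℤ*∣ (sgn a) (det H)))
  where open ContributorSum H α

module _ {A : Set} (c : A → Sign) where

  count : Sign → List A → ℕ
  count s xs = length (filter (λ x → c x Sign.≟ s) xs)

  ∑-signToℤ : ∀ xs → ∑ (signToℤ ∘ c) xs ≡ + count Sign.+ xs - + count Sign.- xs
  ∑-signToℤ []       = refl
  ∑-signToℤ (x ∷ xs) with c x
  ... | Sign.+ = trans (cong (_+_ (+ 1)) (∑-signToℤ xs)) (one-more-plus (+ #⁺) (+ #⁻))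
    where
    #⁺ #⁻ : ℕ
    #⁺ = count Sign.+ xs
    #⁻ = count Sign.- xs
    one-more-plus : ∀ p m → + 1 + (p - m) ≡ (+ 1 + p) - m
    one-more-plus = solve-∀
  ... | Sign.- = trans (cong (_+_ (- + 1)) (∑-signToℤ xs)) (one-more-minus (+ #⁺) (+ #⁻))
    where
    #⁺ #⁻ : ℕ
    #⁺ = count Sign.+ xs
    #⁻ = count Sign.- xs
    one-more-minus : ∀ p m → - + 1 + (p - m) ≡ p - (+ 1 + m)
    one-more-minus = solve-∀

  count⁺+count⁻≡length : ∀ xs → count Sign.+ xs ℕ.+ count Sign.- xs ≡ length xs
  count⁺+count⁻≡length []       = refl
  count⁺+count⁻≡length (x ∷ xs) with c x
  ... | Sign.+ = cong suc (count⁺+count⁻≡length xs)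
  ... | Sign.- = trans (ℕP.+-suc _ _) (cong suc (count⁺+count⁻≡length xs))

+∣i∣≡-i : ∀ {i} → i ≤ + 0 → + ∣ i ∣ ≡ - i
+∣i∣≡-i {+ zero}   _          = refl
+∣i∣≡-i {+ suc n}  (ℤ.+≤+ ())
+∣i∣≡-i {ℤ.-[1+ n ]} _        = refl

difference-via-total : ∀ p m {N} → p + m ≡ N → (p - m ≡ N - + 2 * m) × (p - m ≡ + 2 * p - N)
difference-via-total p m refl = via-m p m , via-p p m
  where
  via-m : ∀ p m → p - m ≡ (p + m) - + 2 * m
  via-m = solve-∀
  via-p : ∀ p m → p - m ≡ + 2 * p - (p + m)
  via-p = solve-∀

neg-difference : ∀ p m → - (p - m) ≡ m - p
neg-difference = solve-∀

corollary6 : (n : ℕ) (H : SignMatrix n) (α : Permutation′ n)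
    → (contributorSum H α ≥ + 0
    → (+ ∣ det H ∣ ≡ + (n !) - + 2 * + A⁻-card H α)
    × (+ ∣ det H ∣ ≡ + 2 * + A⁺-card H α - + (n !)))
    × (contributorSum H α ≤ + 0
    → (+ ∣ det H ∣ ≡ + (n !) - + 2 * + A⁺-card H α)
    × (+ ∣ det H ∣ ≡ + 2 * + A⁻-card H α - + (n !)))
corollary6 n H α = nonneg , nonpos
  where
  s : ℤ
  s = contributorSum H α
  P M : ℕ
  P = A⁺-card H α
  M = A⁻-card H α
  s≡P-M : s ≡ + P - + M
  s≡P-M = ∑-signToℤ (contributorSign H α) (perms n)
  P+M≡n! : P ℕ.+ M ≡ n !
  P+M≡n! = trans (count⁺+count⁻≡length (contributorSign H α) (perms n)) (length-perms n)
  ∣det∣≡∣s∣ : + ∣ det H ∣ ≡ + ∣ s ∣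
  ∣det∣≡∣s∣ = cong +_ (sym (∣contributorSum∣≡∣det∣ H α))
  nonneg : s ≥ + 0 → (+ ∣ det H ∣ ≡ + (n !) - + 2 * + M) × (+ ∣ det H ∣ ≡ + 2 * + P - + (n !))
  nonneg s≥0 = Product.map (trans ∣det∣≡P-M) (trans ∣det∣≡P-M)
    (difference-via-total (+ P) (+ M) (cong +_ P+M≡n!))
    where
    ∣det∣≡P-M : + ∣ det H ∣ ≡ + P - + M
    ∣det∣≡P-M = trans ∣det∣≡∣s∣ (trans (ℤP.0≤i⇒+∣i∣≡i s≥0) s≡P-M)
  nonpos : s ≤ + 0 → (+ ∣ det H ∣ ≡ + (n !) - + 2 * + P) × (+ ∣ det H ∣ ≡ + 2 * + M - + (n !))
  nonpos s≤0 = Product.map (trans ∣det∣≡M-P) (trans ∣det∣≡M-P)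
    (difference-via-total (+ M) (+ P) (cong +_ (trans (ℕP.+-comm M P) P+M≡n!)))
    where
    ∣det∣≡M-P : + ∣ det H ∣ ≡ + M - + P
    ∣det∣≡M-P =
      trans ∣det∣≡∣s∣ (trans (+∣i∣≡-i s≤0) (trans (cong -_ s≡P-M) (neg-difference (+ P) (+ M))))
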